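{- The polynomials $A_d^{(0)}(t)$ and $A_d^{(\neq 0)}(t):=\sum_{s=1}^{r-1}A_d^{(s)}(t)$ are symmetric of degree $d-1$, so these can be expressed as: $$A_d^{(0)}(t)=\sum_{i=0}^{\lfloor\frac{d-1}{2}\rfloor}a^{(0)}(d,i,i)t^i(1+t)^{d-1-2i}$$ and $$A_d^{(\neq 0)}(t)=\sum_{i=0}^{\lfloor\frac{d-1}{2}\rfloor}a^{(\neq 0)}(d,i,i)t^{i}(1+t)^{d-2i},$$ where $a^{(0)}(d,i,i)$ is the number of $r$-colored permutations $\sigma \in A_d^{(0)}$ with $i$ descents and $i+1$ slides; and $a^{(\neq 0)}(d,i,i)$ is the number of $r$-colored permutations $\sigma \in A_d^{(\neq 0)}$ with $i$ descents and $i+1$ slides. In particular, the polynomials $A_d^{(0)}(t)$ and $A_d^{(\neq 0)}(t)$ are $\gamma$-nonnegative.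
   Context: Fix integers $d\geq 1$, $r\geq 1$. The $r$-colored permutation group $\mathbb{Z}_r\wr\Omega_d$ consists of bijections $\sigma$ of $\{1^{(0)},\ldots,d^{(0)},\ldots,1^{(r-1)},\ldots,d^{(r-1)}\}$ with $\sigma(i^{(s)})=j^{(t)}\Rightarrow \sigma(i^{(s+1)})=j^{(t+1)}$ (exponents mod $r$); write $\sigma=(\sigma_1^{\epsilon_1},\ldots,\sigma_d^{\epsilon_d})$, $\epsilon_i$ the color of $\sigma_i$. The descent set is $\mathrm{Des}(\sigma)=\{1\leq i\leq d : \epsilon_i>\epsilon_{i+1}$, or $\epsilon_i=\epsilon_{i+1}$ and $\sigma_i>\sigma_{i+1}\}$ with $\sigma_{d+1}:=d+1$, $\epsilon_{d+1}:=0$, and $\mathrm{des}(\sigma)=|\mathrm{Des}(\sigma)|$. Let $A_d=\{\sigma : \epsilon_1=0\}$, $A_d^{(s)}=\{\sigma\in A_d : \epsilon_d=s\}$, $A_d^{(\neq 0)}=\{\sigma\in A_d:\epsilon_d\neq 0\}$, and $A_d^{(s)}(t)=\sum_{\sigma\in A_d^{(s)}}t^{\mathrm{des}(\sigma)}$. Slides: for $\sigma$, consider $\sigma_0^{\epsilon_0}\sigma_1^{\epsilon_1}\cdots\sigma_d^{\epsilon_d}\sigma_{d+1}^{\epsilon_{d+1}}$ with $\sigma_0=\infty,\epsilon_0=0,\sigma_{d+1}=d+1,\epsilon_{d+1}=0$; put asterisks at both ends and between consecutive entries whenever $\sigma_i^{\epsilon_i}<\sigma_{i+1}^{\epsilon_{i+1}}$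 (i.e. $\epsilon_i<\epsilon_{i+1}$, or $\epsilon_i=\epsilon_{i+1}$ and $\sigma_i<\sigma_{i+1}$). A slide is any segment between asterisks of length at least 2 (a decreasing run of length $\geq 2$). A symmetric polynomial $p$ of degree $n$ is written uniquely as $\sum_i\gamma_i x^i(1+x)^{n-2i}$; it is $\gamma$-nonnegative if all $\gamma_i\geq 0$. -}

module Defs where

open import Data.Bool using (Bool; true; false; _∧_; _∨_; not; if_then_else_)
open import Data.Nat using (ℕ; zero; suc; _+_; _*_; _∸_; _^_; _<ᵇ_; _≡ᵇ_; _≤ᵇ_; _/_)
open import Data.Product using (_×_; _,_; proj₁; proj₂)
open import Data.List using (List; []; _∷_; _++_; [_]; map; concatMap; length; filterᵇ; upTo)
open import Data.Nat.ListAction using (sum)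

-- An r-colored permutation σ = (σ₁^ε₁, …, σ_d^ε_d) is represented by the
-- list of pairs (σᵢ , εᵢ) with σᵢ ∈ {1,…,d}, εᵢ ∈ {0,…,r-1}, values distinct.
-- (Such lists are in bijection with ℤ_r ≀ Ω_d.)

Entry : Set
Entry = ℕ × ℕ

words : ℕ → {A : Set} → List A → List (List A)
words zero    as = [] ∷ []
words (suc n) as = concatMap (λ a → map (a ∷_) (words n as)) as

values : ℕ → List ℕ
values d = map suc (upTo d)

letters : ℕ → ℕ → List Entry
letters d r = concatMap (λ v → map (λ c → (v , c)) (upTo r)) (values d)

notElem : ℕ → List ℕ → Bool
notElem x []       = true
notElem x (y ∷ ys) = not (x ≡ᵇ y) ∧ notElem x ys

distinct : List ℕ → Bool
distinct []       = true
distinct (x ∷ xs) = notElem x xs ∧ distinct xs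

colPerms : ℕ → ℕ → List (List Entry)
colPerms d r = filterᵇ (λ w → distinct (map proj₁ w)) (words d (letters d r))

-- Extended entries: values may be ∞ (for σ₀ = ∞).

data Val : Set where
  ∞   : Val
  fin : ℕ → Val

_<V_ : Val → Val → Bool
∞     <V _     = false
fin m <V ∞     = true
fin m <V fin n = m <ᵇ n

XEntry : Set
XEntry = Val × ℕ

_≺_ : XEntry → XEntry → Bool
(a , e) ≺ (b , f) = (e <ᵇ f) ∨ ((e ≡ᵇ f) ∧ (a <V b))

_≻_ : XEntry → XEntry → Bool
x ≻ y = y ≺ x

ext : Entry → XEntry
ext (v , c) = (fin v , c)

withEnd : ℕ → List Entry → List XEntry
withEnd d σ = map ext σ ++ [ (fin (suc d) , 0) ]

countDesc : List XEntry → ℕ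
countDesc []           = 0
countDesc (x ∷ [])     = 0
countDesc (x ∷ y ∷ ys) = (if x ≻ y then 1 else 0) + countDesc (y ∷ ys)

des : ℕ → List Entry → ℕ
des d σ = countDesc (withEnd d σ)

-- split a nonempty sequence (head x) into the segments between asterisks,
-- an asterisk being placed between consecutive entries x, y with x ≺ y
consHead : XEntry → List (List XEntry) → List (List XEntry)
consHead x []       = (x ∷ []) ∷ []
consHead x (b ∷ bs) = (x ∷ b) ∷ bs

segments : XEntry → List XEntry → List (List XEntry)
segments x []       = (x ∷ []) ∷ []
segments x (y ∷ ys) =
  if x ≺ y then (x ∷ []) ∷ segments y ys else consHead x (segments y ys)

slides : ℕ → List Entry → ℕ
slides d σ = length (filterᵇ (λ b → 2 ≤ᵇ length b) (segments (∞ , 0) (withEnd d σ)))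

firstColor0 : List Entry → Bool
firstColor0 []            = false
firstColor0 ((_ , c) ∷ _) = c ≡ᵇ 0

lastColor : List Entry → ℕ
lastColor []            = 0
lastColor (x ∷ [])      = proj₂ x
lastColor (_ ∷ y ∷ ys)  = lastColor (y ∷ ys)

A : ℕ → ℕ → List (List Entry)
A d r = filterᵇ firstColor0 (colPerms d r)

A⁰ : ℕ → ℕ → List (List Entry)
A⁰ d r = filterᵇ (λ σ → lastColor σ ≡ᵇ 0) (A d r)

A≠0 : ℕ → ℕ → List (List Entry)
A≠0 d r = filterᵇ (λ σ → not (lastColor σ ≡ᵇ 0)) (A d r)

desPoly : ℕ → List (List Entry) → ℕ → ℕ
desPoly d S t = sum (map (λ σ → t ^ des d σ) S)

aCount : ℕ → List (List Entry) → ℕ → ℕ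
aCount d S i = length (filterᵇ (λ σ → (des d σ ≡ᵇ i) ∧ (slides d σ ≡ᵇ suc i)) S)

gammaSum : ℕ → ℕ → (ℕ → ℕ) → ℕ → ℕ
gammaSum m n c t = sum (map (λ i → c i * t ^ i * (1 + t) ^ (n ∸ 2 * i)) (upTo (suc m)))

-- A coloured permutation is read as a word of entries (σᵢ, εᵢ) closed by the walls
-- σ₀ = (∞, 0) and σ_{d+1} = (d+1, 0).  Entries of colour 0 lie below both walls and all other
-- entries above both, so each word splits into maximal runs of low and of high entries; the
-- number of descents, double descents and double ascents is additive over the runs, and each
-- run behaves like an ordinary permutation between two walls ∞₀.  For such a run, splitting
-- every permutation around the entry nearest the walls (valley hopping) gives the Foata–Strehl
-- expansion  ∑ t^des = ∑_{no double descents} t^des (1+t)^{double ascents}.  Finally, a word of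
-- A_d without double descents has des + 1 slides and n − 2·des double ascents, where n is d − 1 or d
-- according as the last colour is 0 or not, which is the claimed γ-expansion.

module Submission where

open import Defs
open import Data.Bool using (Bool; true; false; _∧_; not; if_then_else_; T)
open import Data.Bool.Properties using (not-involutive; ∧-zeroʳ; ∧-assoc; ∧-conicalˡ; ∧-conicalʳ; ∧-commutativeMonoid)
open import Data.Empty using (⊥; ⊥-elim)
open import Data.List using (List; []; _∷_; _++_; [_]; map; concatMap; length; null; filterᵇ; upTo)
open import Data.List.Properties using (++-identityʳ; map-++; length-map; length-upTo; length-++-≤ˡ; length-++-≤ʳ; upTo-∷ʳ; filter-++)
open import Data.List.Relation.Unary.All as All using (All; []; _∷_)
open import Data.List.Relation.Unary.All.Properties using (map⁺; map⁻; ++⁺; ++⁻; ++⁻ˡ; concat⁺; all-upTo)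
open import Data.List.Relation.Unary.AllPairs as AllPairs using (AllPairs; []; _∷_)
open import Data.List.Relation.Unary.Unique.Propositional using (Unique)
import Data.List.Relation.Unary.Unique.Propositional.Properties as Unique
open import Data.List.Relation.Unary.Linked using (Linked; []; [-]; _∷_)
open import Data.List.Relation.Binary.Permutation.Propositional as ↭ using (_↭_; ↭-refl; ↭-prep; ↭-swap; ↭-trans; ↭-sym; ↭⇒↭ₛ)
open import Data.List.Relation.Binary.Permutation.Propositional.Properties using (shift; ↭-length; All-resp-↭)
open import Data.Nat
open import Data.Nat.Properties
open import Data.Nat.DivMod using (m*n/n≡m; /-monoˡ-≤)
open import Data.Nat.ListAction using (sum)
open import Data.Nat.ListAction.Properties using (sum-++)
open import Data.Nat.Solver using (module +-*-Solver)
open import Data.Product using (Σ; _×_; _,_; proj₁; proj₂; map₁; map₂; uncurry)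
open import Data.Sum using (_⊎_; inj₁; inj₂)
open import Data.Unit using (⊤; tt)
open import Function using (_∘_)
open import Relation.Binary.PropositionalEquality using (setoid; _≡_; _≢_; refl; sym; trans; cong; cong₂; subst; subst₂; module ≡-Reasoning)
open import Relation.Nullary.Decidable using (T?)
open import Algebra.Bundles using (CommutativeMonoid)
open import Algebra.Properties.CommutativeSemigroup +-commutativeSemigroup using () renaming (interchange to +-interchange)
open import Algebra.Properties.CommutativeSemigroup *-commutativeSemigroup using (x∙yz≈y∙xz) renaming (interchange to *-interchange)
open import Algebra.Properties.CommutativeSemigroup (CommutativeMonoid.commutativeSemigroup ∧-commutativeMonoid)
  using () renaming (x∙yz≈y∙xz to ∧-x∙yz≈y∙xz)

open +-*-Solver using (solve; _:=_; con; _:+_; _:*_)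

∑ : {A : Set} → List A → (A → ℕ) → ℕ
∑ xs f = sum (map f xs)

-- Written with if_then_else_ so that Defs.countDesc unfolds to sums of indicators.
𝟙 : Bool → ℕ
𝟙 b = if b then 1 else 0

𝟙-∧ : ∀ a b → 𝟙 (a ∧ b) ≡ 𝟙 a * 𝟙 b
𝟙-∧ true  b = sym (+-identityʳ (𝟙 b))
𝟙-∧ false b = refl

module _ {A : Set} where

  ∑-++ : (xs ys : List A) (f : A → ℕ) → ∑ (xs ++ ys) f ≡ ∑ xs f + ∑ ys f
  ∑-++ xs ys f = trans (cong sum (map-++ f xs ys)) (sum-++ (map f xs) (map f ys))

  ∑-cong : (xs : List A) {f g : A → ℕ} → (∀ x → f x ≡ g x) → ∑ xs f ≡ ∑ xs g
  ∑-cong []       f≡g = refl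
  ∑-cong (x ∷ xs) f≡g = cong₂ _+_ (f≡g x) (∑-cong xs f≡g)

  ∑-cong-All : {xs : List A} {f g : A → ℕ} → All (λ x → f x ≡ g x) xs → ∑ xs f ≡ ∑ xs g
  ∑-cong-All []       = refl
  ∑-cong-All (e ∷ es) = cong₂ _+_ e (∑-cong-All es)

  ∑-+ : (xs : List A) (f g : A → ℕ) → ∑ xs (λ x → f x + g x) ≡ ∑ xs f + ∑ xs g
  ∑-+ []       f g = refl
  ∑-+ (x ∷ xs) f g = trans (cong (f x + g x +_) (∑-+ xs f g)) (+-interchange (f x) (g x) _ _)

  ∑-*ˡ : (xs : List A) (c : ℕ) (f : A → ℕ) → ∑ xs (λ x → c * f x) ≡ c * ∑ xs f
  ∑-*ˡ []       c f = sym (*-zeroʳ c)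
  ∑-*ˡ (x ∷ xs) c f = trans (cong (c * f x +_) (∑-*ˡ xs c f)) (sym (*-distribˡ-+ c (f x) _))

  ∑-*ʳ : (xs : List A) (c : ℕ) (f : A → ℕ) → ∑ xs (λ x → f x * c) ≡ ∑ xs f * c
  ∑-*ʳ xs c f = trans (∑-cong xs (λ x → *-comm (f x) c)) (trans (∑-*ˡ xs c f) (*-comm c _))

  ∑-zero : (xs : List A) → ∑ xs (λ _ → 0) ≡ 0
  ∑-zero []       = refl
  ∑-zero (x ∷ xs) = ∑-zero xs

  ∑-filterᵇ : (p : A → Bool) (xs : List A) (f : A → ℕ) → ∑ (filterᵇ p xs) f ≡ ∑ xs (λ x → 𝟙 (p x) * f x)
  ∑-filterᵇ p []       f = refl
  ∑-filterᵇ p (x ∷ xs) f with p x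
  ... | true  = cong₂ _+_ (sym (+-identityʳ (f x))) (∑-filterᵇ p xs f)
  ... | false = ∑-filterᵇ p xs f

  length-filterᵇ-∷ : (p : A → Bool) (x : A) (xs : List A) → length (filterᵇ p (x ∷ xs)) ≡ 𝟙 (p x) + length (filterᵇ p xs)
  length-filterᵇ-∷ p x xs with p x
  ... | true  = refl
  ... | false = refl

  length-filterᵇ : (p : A → Bool) (xs : List A) → length (filterᵇ p xs) ≡ ∑ xs (𝟙 ∘ p)
  length-filterᵇ p []       = refl
  length-filterᵇ p (x ∷ xs) with p x
  ... | true  = cong suc (length-filterᵇ p xs)
  ... | false = length-filterᵇ p xs

module _ {A B : Set} where

  ∑-map : (g : A → B) (xs : List A) (f : B → ℕ) → ∑ (map g xs) f ≡ ∑ xs (f ∘ g)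
  ∑-map g []       f = refl
  ∑-map g (x ∷ xs) f = cong (f (g x) +_) (∑-map g xs f)

  ∑-concatMap : (g : A → List B) (xs : List A) (f : B → ℕ) →
    ∑ (concatMap g xs) f ≡ ∑ xs (λ x → ∑ (g x) f)
  ∑-concatMap g []       f = refl
  ∑-concatMap g (x ∷ xs) f = trans (∑-++ (g x) _ f) (cong (∑ (g x) f +_) (∑-concatMap g xs f))

  ∑-comm : (xs : List A) (ys : List B) (f : A → B → ℕ) →
    ∑ xs (λ x → ∑ ys (f x)) ≡ ∑ ys (λ y → ∑ xs (λ x → f x y))
  ∑-comm []       ys f = sym (∑-zero ys)
  ∑-comm (x ∷ xs) ys f = trans (cong (∑ ys (f x) +_) (∑-comm xs ys f))
    (sym (∑-+ ys (f x) (λ y → ∑ xs (λ x′ → f x′ y))))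

<ᵇ-irrefl : ∀ m → (m <ᵇ m) ≡ false
<ᵇ-irrefl zero    = refl
<ᵇ-irrefl (suc m) = <ᵇ-irrefl m

<ᵇ-asym : ∀ m n → (m <ᵇ n) ≡ true → (n <ᵇ m) ≡ false
<ᵇ-asym zero    (suc n) _   = refl
<ᵇ-asym (suc m) (suc n) m<n = <ᵇ-asym m n m<n

<ᵇ-trans : ∀ m n k → (m <ᵇ n) ≡ true → (n <ᵇ k) ≡ true → (m <ᵇ k) ≡ true
<ᵇ-trans zero    (suc n) (suc k) _   _   = refl
<ᵇ-trans (suc m) (suc n) (suc k) m<n n<k = <ᵇ-trans m n k m<n n<k

<ᵇ⇒≢ᵇ : ∀ m n → (m <ᵇ n) ≡ true → (n ≡ᵇ m) ≡ false
<ᵇ⇒≢ᵇ zero    (suc n) _   = refl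
<ᵇ⇒≢ᵇ (suc m) (suc n) m<n = <ᵇ⇒≢ᵇ m n m<n

≡ᵇ-true⇒≡ : ∀ m n → (m ≡ᵇ n) ≡ true → m ≡ n
≡ᵇ-true⇒≡ zero    zero    _   = refl
≡ᵇ-true⇒≡ (suc m) (suc n) m≡n = cong suc (≡ᵇ-true⇒≡ m n m≡n)

≡ᵇ-refl : ∀ m → (m ≡ᵇ m) ≡ true
≡ᵇ-refl zero    = refl
≡ᵇ-refl (suc m) = ≡ᵇ-refl m

<ᵇ-tri : ∀ m n → (m <ᵇ n) ≡ false → (n <ᵇ m) ≡ false → m ≡ n
<ᵇ-tri zero    zero    _   _   = refl
<ᵇ-tri (suc m) (suc n) m≮n n≮m = cong suc (<ᵇ-tri m n m≮n n≮m)

≡ᵇ-sym : ∀ m n → (m ≡ᵇ n) ≡ (n ≡ᵇ m)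
≡ᵇ-sym zero    zero    = refl
≡ᵇ-sym zero    (suc n) = refl
≡ᵇ-sym (suc m) zero    = refl
≡ᵇ-sym (suc m) (suc n) = ≡ᵇ-sym m n

true≢false : true ≡ false → ⊥
true≢false ()

not≡true : ∀ {a} → not a ≡ true → a ≡ false
not≡true {false} _ = refl

≡not-sym : ∀ {a b} → a ≡ not b → b ≡ not a
≡not-sym {a} {b} a≡¬b = trans (sym (not-involutive b)) (cong not (sym a≡¬b))

T⇒≡true : ∀ {b} → T b → b ≡ true
T⇒≡true {true} _ = refl

𝟙-∧-guard : ∀ k q {x y z} → (k ≡ true → q ≡ true → x ≡ z * y) → 𝟙 (k ∧ q) * x ≡ 𝟙 k * (z * (𝟙 q * y))
𝟙-∧-guard false q             _ = refl
𝟙-∧-guard true  false {z = z} _ = sym (trans (+-identityʳ _) (*-zeroʳ z))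
𝟙-∧-guard true  true  {x} {y} {z} x≡zy =
  trans (cong (1 *_) (x≡zy refl refl)) (cong (λ w → 1 * (z * w)) (sym (*-identityˡ y)))

𝟙-guard-cong : ∀ k {x y} → (k ≡ true → x ≡ y) → 𝟙 k * x ≡ 𝟙 k * y
𝟙-guard-cong false _   = refl
𝟙-guard-cong true  x≡y = cong (1 *_) (x≡y refl)

-- Permutations, cuts and bipartitions of a list

module _ {A : Set} where

  insertions : A → List A → List (List A)
  insertions x []       = [ [ x ] ]
  insertions x (y ∷ ys) = (x ∷ y ∷ ys) ∷ map (y ∷_) (insertions x ys)

  permutations : List A → List (List A)
  permutations []       = [ [] ]
  permutations (x ∷ xs) = concatMap (insertions x) (permutations xs)

  cuts : List A → List (List A × List A)
  cuts []       = [ ([] , []) ]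
  cuts (y ∷ ys) = ([] , y ∷ ys) ∷ map (map₁ (y ∷_)) (cuts ys)

  bipartitions : List A → List (List A × List A)
  bipartitions []       = [ ([] , []) ]
  bipartitions (x ∷ xs) = map (map₁ (x ∷_)) (bipartitions xs) ++ map (map₂ (x ∷_)) (bipartitions xs)

  overCuts : (List A → List A → ℕ) → List A → ℕ
  overCuts ψ w = ∑ (cuts w) (uncurry ψ)

  overPermutations : (List A → List A → ℕ) → List A → List A → ℕ
  overPermutations ψ U V = ∑ (permutations U) (λ u → ∑ (permutations V) (ψ u))

  insertEither : A → (List A → List A → ℕ) → List A → List A → ℕ
  insertEither x ψ p s = ∑ (insertions x p) (λ p′ → ψ p′ s) + ∑ (insertions x s) (ψ p)

  ∑-insertions-∷ : (x y : A) (ys : List A) (f : List A → ℕ) →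
    ∑ (insertions x (y ∷ ys)) f ≡ f (x ∷ y ∷ ys) + ∑ (insertions x ys) (f ∘ (y ∷_))
  ∑-insertions-∷ x y ys f = cong (f (x ∷ y ∷ ys) +_) (∑-map (y ∷_) (insertions x ys) f)

  ∑-cuts-∷ : (y : A) (ys : List A) (ψ : List A → List A → ℕ) →
    overCuts ψ (y ∷ ys) ≡ ψ [] (y ∷ ys) + overCuts (ψ ∘ (y ∷_)) ys
  ∑-cuts-∷ y ys ψ = cong (ψ [] (y ∷ ys) +_) (∑-map (map₁ (y ∷_)) (cuts ys) (uncurry ψ))

  ∑-bipartitions-∷ : (x : A) (xs : List A) (φ : List A → List A → ℕ) →
    ∑ (bipartitions (x ∷ xs)) (uncurry φ) ≡ ∑ (bipartitions xs) (λ (U , V) → φ (x ∷ U) V + φ U (x ∷ V))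
  ∑-bipartitions-∷ x xs φ = begin
      ∑ (map (map₁ (x ∷_)) B ++ map (map₂ (x ∷_)) B) (uncurry φ)
    ≡⟨ ∑-++ (map (map₁ (x ∷_)) B) _ (uncurry φ) ⟩
      ∑ (map (map₁ (x ∷_)) B) (uncurry φ) + ∑ (map (map₂ (x ∷_)) B) (uncurry φ)
    ≡⟨ cong₂ _+_ (∑-map (map₁ (x ∷_)) B (uncurry φ)) (∑-map (map₂ (x ∷_)) B (uncurry φ)) ⟩
      ∑ B (λ (U , V) → φ (x ∷ U) V) + ∑ B (λ (U , V) → φ U (x ∷ V))
    ≡⟨ ∑-+ B _ _ ⟨
      ∑ B (λ (U , V) → φ (x ∷ U) V + φ U (x ∷ V))
    ∎
    where
    open ≡-Reasoning
    B = bipartitions xs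

  ∑-insertions≡∑-cuts : (x : A) (w : List A) (f : List A → ℕ) →
    ∑ (insertions x w) f ≡ overCuts (λ p s → f (p ++ x ∷ s)) w
  ∑-insertions≡∑-cuts x []       f = refl
  ∑-insertions≡∑-cuts x (y ∷ ys) f =
    trans (∑-insertions-∷ x y ys f)
      (trans (cong (f (x ∷ y ∷ ys) +_) (∑-insertions≡∑-cuts x ys (f ∘ (y ∷_))))
        (sym (∑-cuts-∷ y ys (λ p s → f (p ++ x ∷ s)))))

  insertEither-∷ˡ : (x y : A) (ψ : List A → List A → ℕ) (p s : List A) →
    insertEither x ψ (y ∷ p) s ≡ ψ (x ∷ y ∷ p) s + insertEither x (ψ ∘ (y ∷_)) p s
  insertEither-∷ˡ x y ψ p s =
    trans (cong (_+ ∑ (insertions x s) (ψ (y ∷ p))) (∑-insertions-∷ x y p (λ p′ → ψ p′ s)))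
      (+-assoc (ψ (x ∷ y ∷ p) s) _ _)

  ∑-insertions-cuts : (x : A) (w : List A) (ψ : List A → List A → ℕ) →
    ∑ (insertions x w) (overCuts ψ) ≡ overCuts (insertEither x ψ) w
  ∑-insertions-cuts x [] ψ =
    solve 2 (λ a b → (a :+ (b :+ con 0)) :+ con 0 := ((b :+ con 0) :+ (a :+ con 0)) :+ con 0) refl
      (ψ [] [ x ]) (ψ [ x ] [])
  ∑-insertions-cuts x (y ∷ ys) ψ = begin
      ∑ (insertions x (y ∷ ys)) (overCuts ψ)
    ≡⟨ ∑-insertions-∷ x y ys (overCuts ψ) ⟩
      overCuts ψ (x ∷ y ∷ ys) + ∑ (insertions x ys) (overCuts ψ ∘ (y ∷_))
    ≡⟨ cong₂ _+_
         (trans (∑-cuts-∷ x (y ∷ ys) ψ) (cong (a +_) (∑-cuts-∷ y ys (ψ ∘ (x ∷_)))))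
         (trans (∑-cong (insertions x ys) (λ w → ∑-cuts-∷ y w ψ)) (∑-+ (insertions x ys) _ _)) ⟩
      (a + (b + c)) + (e + ∑ (insertions x ys) (overCuts (ψ ∘ (y ∷_))))
    ≡⟨ cong (λ z → (a + (b + c)) + (e + z)) (∑-insertions-cuts x ys (ψ ∘ (y ∷_))) ⟩
      (a + (b + c)) + (e + g)
    ≡⟨ solve 5 (λ a b c e g → (a :+ (b :+ c)) :+ (e :+ g) := ((b :+ con 0) :+ (a :+ e)) :+ (c :+ g))
         refl a b c e g ⟩
      ((b + 0) + (a + e)) + (c + g)
    ≡⟨ cong₂ _+_ (cong (b + 0 +_) (∑-insertions-∷ x y ys (ψ [])))
         (∑-+ (cuts ys) (uncurry (ψ ∘ (x ∷_) ∘ (y ∷_))) (uncurry (insertEither x (ψ ∘ (y ∷_))))) ⟨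
      insertEither x ψ [] (y ∷ ys) + ∑ (cuts ys) (λ (p , s) → ψ (x ∷ y ∷ p) s + insertEither x (ψ ∘ (y ∷_)) p s)
    ≡⟨ cong (insertEither x ψ [] (y ∷ ys) +_) (∑-cong (cuts ys) (λ (p , s) → insertEither-∷ˡ x y ψ p s)) ⟨
      insertEither x ψ [] (y ∷ ys) + overCuts (insertEither x ψ ∘ (y ∷_)) ys
    ≡⟨ ∑-cuts-∷ y ys (insertEither x ψ) ⟨
      overCuts (insertEither x ψ) (y ∷ ys)
    ∎
    where
    open ≡-Reasoning
    a = ψ [] (x ∷ y ∷ ys)
    b = ψ [ x ] (y ∷ ys)
    c = overCuts (ψ ∘ (x ∷_) ∘ (y ∷_)) ys
    e = ∑ (insertions x ys) (ψ [] ∘ (y ∷_))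
    g = overCuts (insertEither x (ψ ∘ (y ∷_))) ys

  ∑-permutations-∷ : (x : A) (xs : List A) (f : List A → ℕ) →
    ∑ (permutations (x ∷ xs)) f ≡ ∑ (permutations xs) (λ w → ∑ (insertions x w) f)
  ∑-permutations-∷ x xs f = ∑-concatMap (insertions x) (permutations xs) f

  overPermutations-insertEither : (x : A) (ψ : List A → List A → ℕ) (U V : List A) →
    overPermutations (insertEither x ψ) U V ≡ overPermutations ψ (x ∷ U) V + overPermutations ψ U (x ∷ V)
  overPermutations-insertEither x ψ U V = begin
      ∑ PU (λ u → ∑ PV (insertEither x ψ u))
    ≡⟨ trans (∑-cong PU (λ u → ∑-+ PV _ _)) (∑-+ PU _ _) ⟩
      ∑ PU (λ u → ∑ PV (λ v → ∑ (insertions x u) (λ u′ → ψ u′ v)))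
        + ∑ PU (λ u → ∑ PV (λ v → ∑ (insertions x v) (ψ u)))
    ≡⟨ cong₂ _+_ (∑-cong PU (λ u → ∑-comm (insertions x u) PV ψ)) (∑-cong PU (λ u → ∑-permutations-∷ x V (ψ u))) ⟨
      ∑ PU (λ u → ∑ (insertions x u) (λ u′ → ∑ PV (ψ u′))) + overPermutations ψ U (x ∷ V)
    ≡⟨ cong (_+ overPermutations ψ U (x ∷ V)) (∑-permutations-∷ x U (λ u′ → ∑ PV (ψ u′))) ⟨
      overPermutations ψ (x ∷ U) V + overPermutations ψ U (x ∷ V)
    ∎
    where
    open ≡-Reasoning
    PU = permutations U
    PV = permutations V

  ∑-permutations-cuts : (X : List A) (ψ : List A → List A → ℕ) →
    ∑ (permutations X) (overCuts ψ) ≡ ∑ (bipartitions X) (uncurry (overPermutations ψ))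
  ∑-permutations-cuts []       ψ = sym (+-identityʳ _)
  ∑-permutations-cuts (x ∷ xs) ψ = begin
      ∑ (permutations (x ∷ xs)) (overCuts ψ)
    ≡⟨ ∑-permutations-∷ x xs (overCuts ψ) ⟩
      ∑ (permutations xs) (λ w → ∑ (insertions x w) (overCuts ψ))
    ≡⟨ ∑-cong (permutations xs) (λ w → ∑-insertions-cuts x w ψ) ⟩
      ∑ (permutations xs) (overCuts (insertEither x ψ))
    ≡⟨ ∑-permutations-cuts xs (insertEither x ψ) ⟩
      ∑ (bipartitions xs) (uncurry (overPermutations (insertEither x ψ)))
    ≡⟨ ∑-cong (bipartitions xs) (λ (U , V) → overPermutations-insertEither x ψ U V) ⟩
      ∑ (bipartitions xs) (λ (U , V) → overPermutations ψ (x ∷ U) V + overPermutations ψ U (x ∷ V))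
    ≡⟨ ∑-bipartitions-∷ x xs (overPermutations ψ) ⟨
      ∑ (bipartitions (x ∷ xs)) (uncurry (overPermutations ψ))
    ∎
    where open ≡-Reasoning

  ∑-insertions²-∷ : (x y z : A) (zs : List A) (f : List A → ℕ) →
    ∑ (insertions y (z ∷ zs)) (λ w → ∑ (insertions x w) f)
      ≡ (f (x ∷ y ∷ z ∷ zs) + (f (y ∷ x ∷ z ∷ zs) + ∑ (insertions x zs) (f ∘ (y ∷_) ∘ (z ∷_))))
        + (∑ (insertions y zs) (f ∘ (x ∷_) ∘ (z ∷_)) + ∑ (insertions y zs) (λ w → ∑ (insertions x w) (f ∘ (z ∷_))))
  ∑-insertions²-∷ x y z zs f =
    trans (∑-insertions-∷ y z zs (λ w → ∑ (insertions x w) f))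
      (cong₂ _+_
        (trans (∑-insertions-∷ x y (z ∷ zs) f) (cong (f (x ∷ y ∷ z ∷ zs) +_) (∑-insertions-∷ x z zs (f ∘ (y ∷_)))))
        (trans (∑-cong (insertions y zs) (λ w → ∑-insertions-∷ x z w f)) (∑-+ (insertions y zs) _ _)))

  ∑-insertions-comm : (x y : A) (w : List A) (f : List A → ℕ) →
    ∑ (insertions y w) (λ w′ → ∑ (insertions x w′) f) ≡ ∑ (insertions x w) (λ w′ → ∑ (insertions y w′) f)
  ∑-insertions-comm x y [] f =
    solve 2 (λ a b → (a :+ (b :+ con 0)) :+ con 0 := (b :+ (a :+ con 0)) :+ con 0) refl
      (f (x ∷ y ∷ [])) (f (y ∷ x ∷ []))
  ∑-insertions-comm x y (z ∷ zs) f = begin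
      ∑ (insertions y (z ∷ zs)) (λ w → ∑ (insertions x w) f)
    ≡⟨ ∑-insertions²-∷ x y z zs f ⟩
      (a + (b + P)) + (Q + ∑ (insertions y zs) (λ w → ∑ (insertions x w) (f ∘ (z ∷_))))
    ≡⟨ cong (λ h → (a + (b + P)) + (Q + h)) (∑-insertions-comm x y zs (f ∘ (z ∷_))) ⟩
      (a + (b + P)) + (Q + I)
    ≡⟨ solve 5 (λ a b P Q I → (a :+ (b :+ P)) :+ (Q :+ I) := (b :+ (a :+ Q)) :+ (P :+ I)) refl a b P Q I ⟩
      (b + (a + Q)) + (P + I)
    ≡⟨ ∑-insertions²-∷ y x z zs f ⟨
      ∑ (insertions x (z ∷ zs)) (λ w → ∑ (insertions y w) f)
    ∎
    where
    open ≡-Reasoning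
    a = f (x ∷ y ∷ z ∷ zs)
    b = f (y ∷ x ∷ z ∷ zs)
    P = ∑ (insertions x zs) (f ∘ (y ∷_) ∘ (z ∷_))
    Q = ∑ (insertions y zs) (f ∘ (x ∷_) ∘ (z ∷_))
    I = ∑ (insertions x zs) (λ w → ∑ (insertions y w) (f ∘ (z ∷_)))

  ∑-permutations-↭ : {X Y : List A} → X ↭ Y → (f : List A → ℕ) → ∑ (permutations X) f ≡ ∑ (permutations Y) f
  ∑-permutations-↭ ↭.refl f = refl
  ∑-permutations-↭ {x ∷ X} {x ∷ Y} (↭.prep x π) f =
    trans (∑-permutations-∷ x X f)
      (trans (∑-permutations-↭ π (λ w → ∑ (insertions x w) f)) (sym (∑-permutations-∷ x Y f)))
  ∑-permutations-↭ {x ∷ y ∷ X} {y ∷ x ∷ Y} (↭.swap x y π) f = begin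
      ∑ (permutations (x ∷ y ∷ X)) f
    ≡⟨ trans (∑-permutations-∷ x (y ∷ X) f) (∑-permutations-∷ y X _) ⟩
      ∑ (permutations X) (λ w → ∑ (insertions y w) (λ w′ → ∑ (insertions x w′) f))
    ≡⟨ ∑-cong (permutations X) (λ w → ∑-insertions-comm x y w f) ⟩
      ∑ (permutations X) (λ w → ∑ (insertions x w) (λ w′ → ∑ (insertions y w′) f))
    ≡⟨ ∑-permutations-↭ π _ ⟩
      ∑ (permutations Y) (λ w → ∑ (insertions x w) (λ w′ → ∑ (insertions y w′) f))
    ≡⟨ trans (∑-permutations-∷ y (x ∷ Y) f) (∑-permutations-∷ x Y _) ⟨
      ∑ (permutations (y ∷ x ∷ Y)) f
    ∎
    where open ≡-Reasoning
  ∑-permutations-↭ (↭.trans π ρ) f = trans (∑-permutations-↭ π f) (∑-permutations-↭ ρ f)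

  ∑-bipartitions-swap : (X : List A) (φ : List A → List A → ℕ) →
    ∑ (bipartitions X) (uncurry φ) ≡ ∑ (bipartitions X) (λ (U , V) → φ V U)
  ∑-bipartitions-swap []       φ = refl
  ∑-bipartitions-swap (x ∷ xs) φ = begin
      ∑ (bipartitions (x ∷ xs)) (uncurry φ)
    ≡⟨ trans (∑-bipartitions-∷ x xs φ) (∑-+ B _ _) ⟩
      ∑ B (λ (U , V) → φ (x ∷ U) V) + ∑ B (λ (U , V) → φ U (x ∷ V))
    ≡⟨ cong₂ _+_ (∑-bipartitions-swap xs (φ ∘ (x ∷_))) (∑-bipartitions-swap xs (λ U V → φ U (x ∷ V))) ⟩
      ∑ B (λ (U , V) → φ (x ∷ V) U) + ∑ B (λ (U , V) → φ V (x ∷ U))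
    ≡⟨ +-comm (∑ B (λ (U , V) → φ (x ∷ V) U)) _ ⟩
      ∑ B (λ (U , V) → φ V (x ∷ U)) + ∑ B (λ (U , V) → φ (x ∷ V) U)
    ≡⟨ trans (∑-bipartitions-∷ x xs (λ U V → φ V U)) (∑-+ B _ _) ⟨
      ∑ (bipartitions (x ∷ xs)) (λ (U , V) → φ V U)
    ∎
    where
    open ≡-Reasoning
    B = bipartitions xs

  ∑-bipartitions-symmetric : (X : List A) (α β h : List A → List A → ℕ) →
    (∀ U V → α U V + α V U ≡ β U V + β V U) → (∀ U V → h U V ≡ h V U) →
    ∑ (bipartitions X) (λ (U , V) → α U V * h U V) ≡ ∑ (bipartitions X) (λ (U , V) → β U V * h U V)
  ∑-bipartitions-symmetric X α β h α∼β h-sym = *-cancelˡ-≡ _ _ 2 (begin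
      2 * ∑ B (λ (U , V) → α U V * h U V)
    ≡⟨ doubled (λ U V → α U V * h U V) ⟩
      ∑ B (λ (U , V) → α U V * h U V + α V U * h V U)
    ≡⟨ ∑-cong B (λ (U , V) → symmetrised U V) ⟩
      ∑ B (λ (U , V) → β U V * h U V + β V U * h V U)
    ≡⟨ doubled (λ U V → β U V * h U V) ⟨
      2 * ∑ B (λ (U , V) → β U V * h U V)
    ∎)
    where
    open ≡-Reasoning
    B = bipartitions X
    doubled : (φ : List A → List A → ℕ) → 2 * ∑ B (uncurry φ) ≡ ∑ B (λ (U , V) → φ U V + φ V U)
    doubled φ = trans (cong (∑ B (uncurry φ) +_) (trans (+-identityʳ _) (∑-bipartitions-swap X φ)))
      (sym (∑-+ B (uncurry φ) (λ (U , V) → φ V U)))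
    symmetrised : ∀ U V → α U V * h U V + α V U * h V U ≡ β U V * h U V + β V U * h V U
    symmetrised U V = begin
        α U V * h U V + α V U * h V U
      ≡⟨ cong (λ z → α U V * h U V + α V U * z) (h-sym V U) ⟩
        α U V * h U V + α V U * h U V
      ≡⟨ *-distribʳ-+ (h U V) (α U V) _ ⟨
        (α U V + α V U) * h U V
      ≡⟨ cong (_* h U V) (α∼β U V) ⟩
        (β U V + β V U) * h U V
      ≡⟨ *-distribʳ-+ (h U V) (β U V) _ ⟩
        β U V * h U V + β V U * h U V
      ≡⟨ cong (λ z → β U V * h U V + β V U * z) (h-sym V U) ⟨
        β U V * h U V + β V U * h V U
      ∎

  insertions-↭ : (x : A) (w : List A) → All (_↭ x ∷ w) (insertions x w)
  insertions-↭ x []       = ↭-refl ∷ []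
  insertions-↭ x (y ∷ ys) =
    ↭-refl ∷ map⁺ (All.map (λ π → ↭-trans (↭-prep y π) (↭-swap y x ↭-refl)) (insertions-↭ x ys))

  permutations-↭ : (X : List A) → All (_↭ X) (permutations X)
  permutations-↭ []       = ↭-refl ∷ []
  permutations-↭ (x ∷ xs) =
    concat⁺ (map⁺ (All.map (λ {w} π → All.map (λ ρ → ↭-trans ρ (↭-prep x π)) (insertions-↭ x w)) (permutations-↭ xs)))

  bipartitions-↭ : (X : List A) → All (λ (U , V) → U ++ V ↭ X) (bipartitions X)
  bipartitions-↭ []       = ↭-refl ∷ []
  bipartitions-↭ (x ∷ xs) =
    ++⁺ (map⁺ (All.map (↭-prep x) (bipartitions-↭ xs)))
        (map⁺ (All.map (λ {(U , V)} π → ↭-trans (shift x U V) (↭-prep x π)) (bipartitions-↭ xs)))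

  headOr : List A → A → A
  headOr []      b = b
  headOr (y ∷ _) b = y

  lastOr : A → List A → A
  lastOr a []       = a
  lastOr a (x ∷ xs) = lastOr x xs

  headOr-++ : ∀ u v b → headOr (u ++ v) b ≡ headOr u (headOr v b)
  headOr-++ []      v b = refl
  headOr-++ (x ∷ u) v b = refl

  lastOr-++ : ∀ a u v → lastOr a (u ++ v) ≡ lastOr (lastOr a u) v
  lastOr-++ a []      v = refl
  lastOr-++ a (x ∷ u) v = lastOr-++ x u v

  lastOr-All : ∀ {P : A → Set} a xs → P a → All P xs → P (lastOr a xs)
  lastOr-All a []       pa []         = pa
  lastOr-All a (x ∷ xs) pa (px ∷ pxs) = lastOr-All x xs px pxs

  allᵇ : (A → Bool) → List A → Bool
  allᵇ p []       = true
  allᵇ p (x ∷ xs) = p x ∧ allᵇ p xs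

  headIs : (A → Bool) → List A → Bool
  headIs p []      = false
  headIs p (x ∷ _) = p x

  lastIs : (A → Bool) → List A → Bool
  lastIs p []       = false
  lastIs p (x ∷ xs) = p (lastOr x xs)

  lastIs-++ : (p : A → Bool) (b c : List A) → lastIs p (b ++ c) ≡ (if null c then lastIs p b else lastIs p c)
  lastIs-++ p b       []      = cong (lastIs p) (++-identityʳ b)
  lastIs-++ p []      (z ∷ c) = refl
  lastIs-++ p (y ∷ b) (z ∷ c) = cong p (lastOr-++ y b (z ∷ c))

  isFirstRun : (A → Bool) → List A → List A → Bool
  isFirstRun p b c = not (null b) ∧ (allᵇ p b ∧ not (headIs p c))

  cuts-++ : (w : List A) → All (λ (b , c) → b ++ c ≡ w) (cuts w)
  cuts-++ []       = refl ∷ []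
  cuts-++ (y ∷ ys) = refl ∷ map⁺ (All.map (cong (y ∷_)) (cuts-++ ys))

  ∑-cuts-maximalPrefix : (p : A → Bool) (w : List A) → ∑ (cuts w) (λ (b , c) → 𝟙 (allᵇ p b ∧ not (headIs p c))) ≡ 1
  ∑-cuts-maximalPrefix p []       = refl
  ∑-cuts-maximalPrefix p (z ∷ zs) rewrite ∑-map (map₁ (z ∷_)) (cuts zs) (λ (b , c) → 𝟙 (allᵇ p b ∧ not (headIs p c))) with p z
  ... | true  = ∑-cuts-maximalPrefix p zs
  ... | false = cong suc (∑-zero (cuts zs))

  ∑-cuts-isFirstRun : (p : A → Bool) (w : List A) → ∑ (cuts w) (𝟙 ∘ uncurry (isFirstRun p)) ≡ 𝟙 (headIs p w)
  ∑-cuts-isFirstRun p []       = refl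
  ∑-cuts-isFirstRun p (y ∷ ys) rewrite ∑-map (map₁ (y ∷_)) (cuts ys) (𝟙 ∘ uncurry (isFirstRun p)) with p y
  ... | true  = ∑-cuts-maximalPrefix p ys
  ... | false = ∑-zero (cuts ys)

  ∑-permutations-firstRun : (p : A → Bool) (X : List A) (Φ : List A → ℕ) →
    ∑ (permutations X) (λ w → 𝟙 (headIs p w) * Φ w)
      ≡ ∑ (bipartitions X) (uncurry (overPermutations (λ b c → 𝟙 (isFirstRun p b c) * Φ (b ++ c))))
  ∑-permutations-firstRun p X Φ = trans (∑-cong (permutations X) cut-at-firstRun) (∑-permutations-cuts X _)
    where
    cut-at-firstRun : ∀ w → 𝟙 (headIs p w) * Φ w ≡ overCuts (λ b c → 𝟙 (isFirstRun p b c) * Φ (b ++ c)) w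
    cut-at-firstRun w = sym (trans (∑-cong-All (All.map (λ {(b , c)} b++c≡w → cong (λ z → 𝟙 (isFirstRun p b c) * Φ z) b++c≡w) (cuts-++ w)))
      (trans (∑-*ʳ (cuts w) (Φ w) (𝟙 ∘ uncurry (isFirstRun p))) (cong (_* Φ w) (∑-cuts-isFirstRun p w))))

  allᵇ-↭ : (p : A → Bool) {u U : List A} → u ↭ U → allᵇ p u ≡ allᵇ p U
  allᵇ-↭ p ↭.refl           = refl
  allᵇ-↭ p (↭.prep x π)     = cong (p x ∧_) (allᵇ-↭ p π)
  allᵇ-↭ p (↭.swap x y π)   = trans (cong (λ z → p x ∧ (p y ∧ z)) (allᵇ-↭ p π)) (∧-x∙yz≈y∙xz (p x) (p y) _)
  allᵇ-↭ p (↭.trans π ρ)    = trans (allᵇ-↭ p π) (allᵇ-↭ p ρ)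

  allᵇ⇒All : (p : A → Bool) (b : List A) → allᵇ p b ≡ true → All (λ y → p y ≡ true) b
  allᵇ⇒All p []       _  = []
  allᵇ⇒All p (y ∷ ys) py∧ = ∧-conicalˡ (p y) _ py∧ ∷ allᵇ⇒All p ys (∧-conicalʳ (p y) _ py∧)

  null-↭ : {u U : List A} → u ↭ U → null u ≡ null U
  null-↭ {[]}    {[]}    _ = refl
  null-↭ {_ ∷ _} {_ ∷ _} _ = refl
  null-↭ {[]}    {_ ∷ _} π with () ← ↭-length π
  null-↭ {_ ∷ _} {[]}    π with () ← ↭-length π

  AllPairs-++⁻ : {R : A → A → Set} (xs : List A) {ys : List A} → AllPairs R (xs ++ ys) → AllPairs R xs × AllPairs R ys
  AllPairs-++⁻ []       rs         = [] , rs
  AllPairs-++⁻ (x ∷ xs) (r ∷ rs) = (++⁻ˡ xs r ∷ proj₁ (AllPairs-++⁻ xs rs)) , proj₂ (AllPairs-++⁻ xs rs)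

  Unique-↭ : {X Y : List A} → X ↭ Y → Unique X → Unique Y
  Unique-↭ π = Unique-resp-↭ (↭⇒↭ₛ π)
    where open import Data.List.Relation.Binary.Permutation.Setoid.Properties (setoid A) using (Unique-resp-↭)

  module _ (U V : List A) {X : List A} (π : U ++ V ↭ X) where

    All-++-↭ : {P : A → Set} → All P X → All P U × All P V
    All-++-↭ pX = ++⁻ U (All-resp-↭ (↭-sym π) pX)

    Unique-++-↭ : Unique X → Unique U × Unique V
    Unique-++-↭ uX = AllPairs-++⁻ U (Unique-↭ (↭-sym π) uX)

    length-++-↭ : length U ≤ length X × length V ≤ length X
    length-++-↭ = ≤-trans (length-++-≤ˡ U) |U++V| , ≤-trans (length-++-≤ʳ V {U}) |U++V|
      where |U++V| = ≤-reflexive (↭-length π)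

  length-++-↭-rest : (B C : List A) {X : List A} {n : ℕ} → B ++ C ↭ X → length X ≤ suc n → null B ≡ false → length C ≤ n
  length-++-↭-rest (y ∷ B) C ρ |X|≤1+n _ =
    ≤-pred (≤-trans (s≤s (length-++-≤ʳ C {B})) (≤-trans (≤-reflexive (↭-length ρ)) |X|≤1+n))

  ∑-permutations-around : (M : A) (X : List A) (F : List A → ℕ) →
    ∑ (permutations (M ∷ X)) F ≡ ∑ (bipartitions X) (uncurry (overPermutations (λ u v → F (u ++ M ∷ v))))
  ∑-permutations-around M X F =
    trans (∑-permutations-∷ M X F)
      (trans (∑-cong (permutations X) (λ w → ∑-insertions≡∑-cuts M w F)) (∑-permutations-cuts X _))

  overPermutations-factor : (ψ : List A → List A → ℕ) (F G : List A → ℕ) (c : ℕ) {U V : List A} →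
    (∀ {u v} → u ↭ U → v ↭ V → ψ u v ≡ c * (F u * G v)) →
    overPermutations ψ U V ≡ c * (∑ (permutations U) F * ∑ (permutations V) G)
  overPermutations-factor ψ F G c {U} {V} factor = begin
      ∑ (permutations U) (λ u → ∑ (permutations V) (ψ u))
    ≡⟨ ∑-cong-All (All.map (λ πu → ∑-cong-All (All.map (factor πu) (permutations-↭ V))) (permutations-↭ U)) ⟩
      ∑ (permutations U) (λ u → ∑ (permutations V) (λ v → c * (F u * G v)))
    ≡⟨ ∑-cong (permutations U) (λ u → trans (∑-*ˡ (permutations V) c (λ v → F u * G v)) (cong (c *_) (∑-*ˡ (permutations V) (F u) G))) ⟩
      ∑ (permutations U) (λ u → c * (F u * ∑ (permutations V) G))
    ≡⟨ trans (∑-*ˡ (permutations U) c (λ u → F u * ∑ (permutations V) G)) (cong (c *_) (∑-*ʳ (permutations U) _ F)) ⟩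
      c * (∑ (permutations U) F * ∑ (permutations V) G)
    ∎
    where open ≡-Reasoning

  picks : List A → List (A × List A)
  picks []       = []
  picks (x ∷ xs) = (x , xs) ∷ map (map₂ (x ∷_)) (picks xs)

  insertionsAfterHead : A → List A → (List A → ℕ) → ℕ
  insertionsAfterHead y []       f = 0
  insertionsAfterHead y (z ∷ zs) f = ∑ (insertions y zs) (f ∘ (z ∷_))

  ∑-insertions-head : (y : A) (w : List A) (f : List A → ℕ) → ∑ (insertions y w) f ≡ f (y ∷ w) + insertionsAfterHead y w f
  ∑-insertions-head y []       f = refl
  ∑-insertions-head y (z ∷ zs) f = ∑-insertions-∷ y z zs f

  ∑-permutations-picks : (y : A) (Y : List A) (f : List A → ℕ) →
    ∑ (permutations (y ∷ Y)) f ≡ ∑ (picks (y ∷ Y)) (λ (z , rest) → ∑ (permutations rest) (f ∘ (z ∷_)))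
  ∑-permutations-picks y Y f = begin
      ∑ (permutations (y ∷ Y)) f
    ≡⟨ ∑-permutations-∷ y Y f ⟩
      ∑ (permutations Y) (λ w → ∑ (insertions y w) f)
    ≡⟨ trans (∑-cong (permutations Y) (λ w → ∑-insertions-head y w f)) (∑-+ (permutations Y) _ _) ⟩
      ∑ (permutations Y) (f ∘ (y ∷_)) + ∑ (permutations Y) (λ w → insertionsAfterHead y w f)
    ≡⟨ cong (∑ (permutations Y) (f ∘ (y ∷_)) +_) (trans (later Y) (sym (∑-map (map₂ (y ∷_)) (picks Y) _))) ⟩
      ∑ (picks (y ∷ Y)) (λ (z , rest) → ∑ (permutations rest) (f ∘ (z ∷_)))
    ∎
    where
    open ≡-Reasoning
    later : ∀ Y → ∑ (permutations Y) (λ w → insertionsAfterHead y w f)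
                    ≡ ∑ (picks Y) (λ (z , rest) → ∑ (permutations (y ∷ rest)) (f ∘ (z ∷_)))
    later []       = refl
    later (z ∷ zs) = trans (∑-permutations-picks z zs _)
      (∑-cong (picks (z ∷ zs)) (λ (z′ , rest) → sym (∑-permutations-∷ y rest (f ∘ (z′ ∷_)))))

module _ {A B : Set} (g : A → B) where

  ∑-insertions-map : (x : A) (w : List A) (f : List B → ℕ) →
    ∑ (insertions (g x) (map g w)) f ≡ ∑ (insertions x w) (f ∘ map g)
  ∑-insertions-map x []       f = refl
  ∑-insertions-map x (y ∷ ys) f =
    trans (∑-insertions-∷ (g x) (g y) (map g ys) f)
      (trans (cong (f (g x ∷ g y ∷ map g ys) +_) (∑-insertions-map x ys (f ∘ (g y ∷_))))
        (sym (∑-insertions-∷ x y ys (f ∘ map g))))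

  ∑-permutations-map : (X : List A) (f : List B → ℕ) → ∑ (permutations (map g X)) f ≡ ∑ (permutations X) (f ∘ map g)
  ∑-permutations-map []       f = refl
  ∑-permutations-map (x ∷ xs) f =
    trans (∑-permutations-∷ (g x) (map g xs) f)
      (trans (∑-permutations-map xs (λ w → ∑ (insertions (g x) w) f))
        (trans (∑-cong (permutations xs) (λ w → ∑-insertions-map x w f)) (sym (∑-permutations-∷ x xs _))))

<V-asym : ∀ a b → (a <V b) ≡ true → (b <V a) ≡ false
<V-asym (fin m) ∞       _   = refl
<V-asym (fin m) (fin n) m<n = <ᵇ-asym m n m<n

<V-trans : ∀ a b c → (a <V b) ≡ true → (b <V c) ≡ true → (a <V c) ≡ true
<V-trans (fin m) (fin n) ∞       _   _   = refl
<V-trans (fin m) (fin n) (fin k) m<n n<k = <ᵇ-trans m n k m<n n<k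

<V-tri : ∀ a b → (a <V b) ≡ false → (b <V a) ≡ false → a ≡ b
<V-tri ∞       ∞       _   _   = refl
<V-tri (fin m) (fin n) m≮n n≮m = cong fin (<ᵇ-tri m n m≮n n≮m)

≺-asym : ∀ x y → (x ≺ y) ≡ true → (y ≺ x) ≡ false
≺-asym (a , e) (b , f) x≺y with e <ᵇ f in e<f
... | true rewrite <ᵇ-asym e f e<f | <ᵇ⇒≢ᵇ e f e<f = refl
... | false with e ≡ᵇ f in e≡f
... | true rewrite ≡ᵇ-true⇒≡ e f e≡f | <ᵇ-irrefl f | ≡ᵇ-refl f = <V-asym a b x≺y

≺-trans : ∀ x y z → (x ≺ y) ≡ true → (y ≺ z) ≡ true → (x ≺ z) ≡ true
≺-trans (a , e) (b , f) (c , g) x≺y y≺z with e <ᵇ f in e<f | f <ᵇ g in f<g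
... | true  | true rewrite <ᵇ-trans e f g e<f f<g = refl
... | true  | false with f ≡ᵇ g in f≡g
... | true rewrite sym (≡ᵇ-true⇒≡ f g f≡g) | e<f = refl
≺-trans (a , e) (b , f) (c , g) x≺y y≺z | false | true with e ≡ᵇ f in e≡f
... | true rewrite ≡ᵇ-true⇒≡ e f e≡f | f<g = refl
≺-trans (a , e) (b , f) (c , g) x≺y y≺z | false | false with e ≡ᵇ f in e≡f | f ≡ᵇ g in f≡g
... | true | true rewrite ≡ᵇ-true⇒≡ e f e≡f | ≡ᵇ-true⇒≡ f g f≡g | <ᵇ-irrefl g | ≡ᵇ-refl g = <V-trans a b c x≺y y≺z

≺-tri : ∀ x y → (x ≺ y) ≡ false → (y ≺ x) ≡ false → x ≡ y
≺-tri (a , e) (b , f) x⊀y y⊀x with e <ᵇ f in e<f | f <ᵇ e in f<e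
... | false | false with <ᵇ-tri e f e<f f<e
... | refl rewrite ≡ᵇ-refl e = cong (_, e) (<V-tri a b x⊀y y⊀x)

≻-asym : ∀ x y → (x ≻ y) ≡ true → (y ≻ x) ≡ false
≻-asym x y = ≺-asym y x

≻-trans : ∀ x y z → (x ≻ y) ≡ true → (y ≻ z) ≡ true → (x ≻ z) ≡ true
≻-trans x y z x≻y y≻z = ≺-trans z y x y≻z x≻y

data Comparable (x y : XEntry) : Set where
  above : (x ≻ y) ≡ true  → (y ≻ x) ≡ false → Comparable x y
  below : (x ≻ y) ≡ false → (y ≻ x) ≡ true  → Comparable x y

comparable : ∀ x y → x ≢ y → Comparable x y
comparable x y x≢y with y ≺ x in y≺x | x ≺ y in x≺y
... | true  | true  = ⊥-elim (true≢false (trans (sym x≺y) (≺-asym y x y≺x)))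
... | true  | false = above y≺x x≺y
... | false | true  = below y≺x x≺y
... | false | false = ⊥-elim (x≢y (≺-tri x y x≺y y≺x))

Comparable⇒≡not : ∀ {x y} → Comparable x y → (x ≻ y) ≡ not (y ≻ x)
Comparable⇒≡not (above x≻y y⊁x) = trans x≻y (sym (cong not y⊁x))
Comparable⇒≡not (below x⊁y y≻x) = trans x⊁y (sym (cong not y≻x))

-- Descents, double descents and double ascents between walls

descents : List XEntry → XEntry → ℕ
descents []       b = 0
descents (x ∷ xs) b = 𝟙 (x ≻ headOr xs b) + descents xs b

doubleDescents : XEntry → List XEntry → XEntry → ℕ
doubleDescents a []       b = 0
doubleDescents a (x ∷ xs) b = 𝟙 ((a ≻ x) ∧ (x ≻ headOr xs b)) + doubleDescents x xs b

doubleAscents : XEntry → List XEntry → XEntry → ℕ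
doubleAscents a []       b = 0
doubleAscents a (x ∷ xs) b = 𝟙 ((x ≻ a) ∧ (headOr xs b ≻ x)) + doubleAscents x xs b

descents-++ : ∀ u v b → descents (u ++ v) b ≡ descents u (headOr v b) + descents v b
descents-++ []      v b = refl
descents-++ (x ∷ u) v b rewrite headOr-++ u v b | descents-++ u v b =
  sym (+-assoc (𝟙 (x ≻ headOr u (headOr v b))) _ _)

doubleDescents-++ : ∀ a u v b →
  doubleDescents a (u ++ v) b ≡ doubleDescents a u (headOr v b) + doubleDescents (lastOr a u) v b
doubleDescents-++ a []      v b = refl
doubleDescents-++ a (x ∷ u) v b rewrite headOr-++ u v b | doubleDescents-++ x u v b =
  sym (+-assoc (𝟙 ((a ≻ x) ∧ (x ≻ headOr u (headOr v b)))) _ _)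

doubleAscents-++ : ∀ a u v b →
  doubleAscents a (u ++ v) b ≡ doubleAscents a u (headOr v b) + doubleAscents (lastOr a u) v b
doubleAscents-++ a []      v b = refl
doubleAscents-++ a (x ∷ u) v b rewrite headOr-++ u v b | doubleAscents-++ x u v b =
  sym (+-assoc (𝟙 ((x ≻ a) ∧ (headOr u (headOr v b) ≻ x))) _ _)

Interchangeable : XEntry → XEntry → XEntry → Set
Interchangeable b b′ x = ((x ≻ b) ≡ (x ≻ b′)) × ((b ≻ x) ≡ (b′ ≻ x))

OnHead : (XEntry → Set) → List XEntry → Set
OnHead P []      = ⊤
OnHead P (x ∷ _) = P x

All⇒OnHead : ∀ {P w} → All P w → OnHead P w
All⇒OnHead []      = tt
All⇒OnHead (p ∷ _) = p

descents-wallʳ : ∀ u b b′ → All (Interchangeable b b′) u → descents u b ≡ descents u b′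
descents-wallʳ []          b b′ _               = refl
descents-wallʳ (x ∷ [])    b b′ ((x≻ , _) ∷ _)  = cong (λ z → 𝟙 z + 0) x≻
descents-wallʳ (x ∷ y ∷ u) b b′ (_ ∷ ss)        = cong (𝟙 (x ≻ y) +_) (descents-wallʳ (y ∷ u) b b′ ss)

doubleDescents-wallʳ : ∀ a u b b′ → All (Interchangeable b b′) u → doubleDescents a u b ≡ doubleDescents a u b′
doubleDescents-wallʳ a []          b b′ _              = refl
doubleDescents-wallʳ a (x ∷ [])    b b′ ((x≻ , _) ∷ _) = cong (λ z → 𝟙 ((a ≻ x) ∧ z) + 0) x≻
doubleDescents-wallʳ a (x ∷ y ∷ u) b b′ (_ ∷ ss)       =
  cong (𝟙 ((a ≻ x) ∧ (x ≻ y)) +_) (doubleDescents-wallʳ x (y ∷ u) b b′ ss)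

doubleAscents-wallʳ : ∀ a u b b′ → All (Interchangeable b b′) u → doubleAscents a u b ≡ doubleAscents a u b′
doubleAscents-wallʳ a []          b b′ _              = refl
doubleAscents-wallʳ a (x ∷ [])    b b′ ((_ , ≻x) ∷ _) = cong (λ z → 𝟙 ((x ≻ a) ∧ z) + 0) ≻x
doubleAscents-wallʳ a (x ∷ y ∷ u) b b′ (_ ∷ ss)       =
  cong (𝟙 ((x ≻ a) ∧ (y ≻ x)) +_) (doubleAscents-wallʳ x (y ∷ u) b b′ ss)

doubleDescents-wallˡ : ∀ a a′ u b → OnHead (Interchangeable a a′) u → doubleDescents a u b ≡ doubleDescents a′ u b
doubleDescents-wallˡ a a′ []      b _        = refl
doubleDescents-wallˡ a a′ (x ∷ u) b (_ , ≻x) = cong (λ z → 𝟙 (z ∧ (x ≻ headOr u b)) + doubleDescents x u b) ≻x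

doubleAscents-wallˡ : ∀ a a′ u b → OnHead (Interchangeable a a′) u → doubleAscents a u b ≡ doubleAscents a′ u b
doubleAscents-wallˡ a a′ []      b _        = refl
doubleAscents-wallˡ a a′ (x ∷ u) b (x≻ , _) = cong (λ z → 𝟙 (z ∧ (headOr u b ≻ x)) + doubleAscents x u b) x≻

-- The γ-expansion between two walls ∞₀

∞₀ : XEntry
∞₀ = (∞ , 0)

desWeight : ℕ → XEntry → List XEntry → ℕ
desWeight t b w = t ^ descents w b

γMonomial : ℕ → ℕ → ℕ → ℕ → ℕ
γMonomial t e d a = 𝟙 (e ≡ᵇ 0) * (t ^ d * (1 + t) ^ a)

𝟙-+≡ᵇ0 : ∀ m n → 𝟙 ((m + n) ≡ᵇ 0) ≡ 𝟙 (m ≡ᵇ 0) * 𝟙 (n ≡ᵇ 0)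
𝟙-+≡ᵇ0 zero    n = sym (+-identityʳ _)
𝟙-+≡ᵇ0 (suc m) n = refl

γMonomial-+ : ∀ t e₁ e₂ d₁ d₂ a₁ a₂ →
  γMonomial t (e₁ + e₂) (d₁ + d₂) (a₁ + a₂) ≡ γMonomial t e₁ d₁ a₁ * γMonomial t e₂ d₂ a₂
γMonomial-+ t e₁ e₂ d₁ d₂ a₁ a₂ = begin
    𝟙 ((e₁ + e₂) ≡ᵇ 0) * (t ^ (d₁ + d₂) * (1 + t) ^ (a₁ + a₂))
  ≡⟨ cong₂ _*_ (𝟙-+≡ᵇ0 e₁ e₂) (cong₂ _*_ (^-distribˡ-+-* t d₁ d₂) (^-distribˡ-+-* (1 + t) a₁ a₂)) ⟩
    (𝟙 (e₁ ≡ᵇ 0) * 𝟙 (e₂ ≡ᵇ 0)) * ((t ^ d₁ * t ^ d₂) * ((1 + t) ^ a₁ * (1 + t) ^ a₂))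
  ≡⟨ cong (𝟙 (e₁ ≡ᵇ 0) * 𝟙 (e₂ ≡ᵇ 0) *_) (*-interchange (t ^ d₁) _ _ _) ⟩
    (𝟙 (e₁ ≡ᵇ 0) * 𝟙 (e₂ ≡ᵇ 0)) * ((t ^ d₁ * (1 + t) ^ a₁) * (t ^ d₂ * (1 + t) ^ a₂))
  ≡⟨ *-interchange (𝟙 (e₁ ≡ᵇ 0)) _ _ _ ⟩
    γMonomial t e₁ d₁ a₁ * γMonomial t e₂ d₂ a₂
  ∎
  where open ≡-Reasoning

γWeight : ℕ → XEntry → XEntry → List XEntry → ℕ
γWeight t a b w = γMonomial t (doubleDescents a w b) (descents w b) (doubleAscents a w b)

OnSide : Bool → XEntry → Set
OnSide f x = (if f then ∞₀ ≻ x else x ≻ ∞₀) ≡ true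

Nearer : Bool → XEntry → XEntry → Set
Nearer f M y = (if f then M ≻ y else y ≻ M) ≡ true

Beyond : Bool → XEntry → XEntry → Set
Beyond f M y = OnSide f y × Nearer f M y

beyond⇒interchangeable : ∀ f M y → Beyond f M y → Interchangeable M ∞₀ y
beyond⇒interchangeable true  M y (∞₀≻y , M≻y) = trans (≻-asym M y M≻y) (sym (≻-asym ∞₀ y ∞₀≻y)) , trans M≻y (sym ∞₀≻y)
beyond⇒interchangeable false M y (y≻∞₀ , y≻M) = trans y≻M (sym y≻∞₀) , trans (≻-asym y M y≻M) (sym (≻-asym y ∞₀ y≻∞₀))

≻-headOr : ∀ f M v → OnSide f M → All (Nearer f M) v → (M ≻ headOr v ∞₀) ≡ (if f then not (null v) else null v)
≻-headOr true  M []      M≺∞₀ _         = ≻-asym ∞₀ M M≺∞₀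
≻-headOr false M []      M≻∞₀ _         = M≻∞₀
≻-headOr true  M (z ∷ v) _    (M≻z ∷ _) = M≻z
≻-headOr false M (z ∷ v) _    (z≻M ∷ _) = ≻-asym z M z≻M

headOr-≻ : ∀ f M v → OnSide f M → All (Nearer f M) v → (headOr v ∞₀ ≻ M) ≡ (if f then null v else not (null v))
headOr-≻ true  M []      M≺∞₀ _         = M≺∞₀
headOr-≻ false M []      M≻∞₀ _         = ≻-asym M ∞₀ M≻∞₀
headOr-≻ true  M (z ∷ v) _    (M≻z ∷ _) = ≻-asym M z M≻z
headOr-≻ false M (z ∷ v) _    (z≻M ∷ _) = z≻M

lastOr-≻ : ∀ f M u → OnSide f M → All (Nearer f M) u → (lastOr ∞₀ u ≻ M) ≡ (if f then null u else not (null u))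
lastOr-≻ true  M []      M≺∞₀ _            = M≺∞₀
lastOr-≻ false M []      M≻∞₀ _            = ≻-asym M ∞₀ M≻∞₀
lastOr-≻ true  M (z ∷ u) _    (M≻z ∷ M≻u)  =
  lastOr-All {P = λ y → (y ≻ M) ≡ false} z u (≻-asym M z M≻z) (All.map (≻-asym M _) M≻u)
lastOr-≻ false M (z ∷ u) _    (z≻M ∷ u≻M)  = lastOr-All {P = λ y → (y ≻ M) ≡ true} z u z≻M u≻M

≻-lastOr : ∀ f M u → OnSide f M → All (Nearer f M) u → (M ≻ lastOr ∞₀ u) ≡ (if f then not (null u) else null u)
≻-lastOr true  M []      M≺∞₀ _            = ≻-asym ∞₀ M M≺∞₀
≻-lastOr false M []      M≻∞₀ _            = M≻∞₀
≻-lastOr true  M (z ∷ u) _    (M≻z ∷ M≻u)  = lastOr-All {P = λ y → (M ≻ y) ≡ true} z u M≻z M≻u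
≻-lastOr false M (z ∷ u) _    (z≻M ∷ u≻M)  =
  lastOr-All {P = λ y → (M ≻ y) ≡ false} z u (≻-asym z M z≻M) (All.map (≻-asym _ M) u≻M)

descentAt : Bool → Bool → Bool → Bool
descentAt f nu nv = if f then not nv else nv

doubleDescentAt : Bool → Bool → Bool → Bool
doubleDescentAt f nu nv = (if f then nu else not nu) ∧ (if f then not nv else nv)

doubleAscentAt : Bool → Bool → Bool → Bool
doubleAscentAt f nu nv = (if f then not nu else nu) ∧ (if f then nv else not nv)

desFactor : ℕ → Bool → Bool → Bool → ℕ
desFactor t f nu nv = t ^ 𝟙 (descentAt f nu nv)

γFactor : ℕ → Bool → Bool → Bool → ℕ
γFactor t f nu nv = γMonomial t (𝟙 (doubleDescentAt f nu nv)) (𝟙 (descentAt f nu nv)) (𝟙 (doubleAscentAt f nu nv))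

module _ (f : Bool) (M : XEntry) (M-on : OnSide f M) (u v : List XEntry)
         (u-beyond : All (Beyond f M) u) (v-beyond : All (Beyond f M) v) where

  private
    u-nearer = All.map proj₂ u-beyond
    v-nearer = All.map proj₂ v-beyond
    u-wall = All.map (beyond⇒interchangeable f M _) u-beyond
    v-wall = All.map (beyond⇒interchangeable f M _) v-beyond

  descents-around : descents (u ++ M ∷ v) ∞₀ ≡ descents u ∞₀ + (𝟙 (descentAt f (null u) (null v)) + descents v ∞₀)
  descents-around = trans (descents-++ u (M ∷ v) ∞₀)
    (cong₂ _+_ (descents-wallʳ u M ∞₀ u-wall) (cong (λ z → 𝟙 z + descents v ∞₀) (≻-headOr f M v M-on v-nearer)))

  doubleDescents-around : doubleDescents ∞₀ (u ++ M ∷ v) ∞₀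
    ≡ doubleDescents ∞₀ u ∞₀ + (𝟙 (doubleDescentAt f (null u) (null v)) + doubleDescents ∞₀ v ∞₀)
  doubleDescents-around = trans (doubleDescents-++ ∞₀ u (M ∷ v) ∞₀)
    (cong₂ _+_ (doubleDescents-wallʳ ∞₀ u M ∞₀ u-wall)
      (cong₂ _+_ (cong 𝟙 (cong₂ _∧_ (lastOr-≻ f M u M-on u-nearer) (≻-headOr f M v M-on v-nearer)))
        (doubleDescents-wallˡ M ∞₀ v ∞₀ (All⇒OnHead v-wall))))

  doubleAscents-around : doubleAscents ∞₀ (u ++ M ∷ v) ∞₀
    ≡ doubleAscents ∞₀ u ∞₀ + (𝟙 (doubleAscentAt f (null u) (null v)) + doubleAscents ∞₀ v ∞₀)
  doubleAscents-around = trans (doubleAscents-++ ∞₀ u (M ∷ v) ∞₀)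
    (cong₂ _+_ (doubleAscents-wallʳ ∞₀ u M ∞₀ u-wall)
      (cong₂ _+_ (cong 𝟙 (cong₂ _∧_ (≻-lastOr f M u M-on u-nearer) (headOr-≻ f M v M-on v-nearer)))
        (doubleAscents-wallˡ M ∞₀ v ∞₀ (All⇒OnHead v-wall))))

  desWeight-around : ∀ t →
    desWeight t ∞₀ (u ++ M ∷ v) ≡ desFactor t f (null u) (null v) * (desWeight t ∞₀ u * desWeight t ∞₀ v)
  desWeight-around t = begin
      t ^ descents (u ++ M ∷ v) ∞₀
    ≡⟨ cong (t ^_) descents-around ⟩
      t ^ (descents u ∞₀ + (𝟙 (descentAt f (null u) (null v)) + descents v ∞₀))
    ≡⟨ ^-distribˡ-+-* t (descents u ∞₀) _ ⟩
      t ^ descents u ∞₀ * t ^ (𝟙 (descentAt f (null u) (null v)) + descents v ∞₀)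
    ≡⟨ cong (t ^ descents u ∞₀ *_) (^-distribˡ-+-* t (𝟙 (descentAt f (null u) (null v))) (descents v ∞₀)) ⟩
      t ^ descents u ∞₀ * (desFactor t f (null u) (null v) * t ^ descents v ∞₀)
    ≡⟨ x∙yz≈y∙xz (t ^ descents u ∞₀) (desFactor t f (null u) (null v)) (t ^ descents v ∞₀) ⟩
      desFactor t f (null u) (null v) * (t ^ descents u ∞₀ * t ^ descents v ∞₀)
    ∎
    where open ≡-Reasoning

  γWeight-around : ∀ t →
    γWeight t ∞₀ ∞₀ (u ++ M ∷ v) ≡ γFactor t f (null u) (null v) * (γWeight t ∞₀ ∞₀ u * γWeight t ∞₀ ∞₀ v)
  γWeight-around t = begin
      γMonomial t (doubleDescents ∞₀ (u ++ M ∷ v) ∞₀) (descents (u ++ M ∷ v) ∞₀) (doubleAscents ∞₀ (u ++ M ∷ v) ∞₀)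
    ≡⟨ trans (cong₂ (λ e d → γMonomial t e d (doubleAscents ∞₀ (u ++ M ∷ v) ∞₀)) doubleDescents-around descents-around)
             (cong (γMonomial t (Eu + (ε + Ev)) (Du + (δ + Dv))) doubleAscents-around) ⟩
      γMonomial t (Eu + (ε + Ev)) (Du + (δ + Dv)) (Au + (η + Av))
    ≡⟨ γMonomial-+ t Eu (ε + Ev) Du (δ + Dv) Au (η + Av) ⟩
      γMonomial t Eu Du Au * γMonomial t (ε + Ev) (δ + Dv) (η + Av)
    ≡⟨ cong (γMonomial t Eu Du Au *_) (γMonomial-+ t ε Ev δ Dv η Av) ⟩
      γMonomial t Eu Du Au * (γMonomial t ε δ η * γMonomial t Ev Dv Av)
    ≡⟨ x∙yz≈y∙xz (γMonomial t Eu Du Au) (γMonomial t ε δ η) (γMonomial t Ev Dv Av) ⟩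
      γMonomial t ε δ η * (γMonomial t Eu Du Au * γMonomial t Ev Dv Av)
    ∎
    where
    open ≡-Reasoning
    Eu = doubleDescents ∞₀ u ∞₀
    Ev = doubleDescents ∞₀ v ∞₀
    Du = descents u ∞₀
    Dv = descents v ∞₀
    Au = doubleAscents ∞₀ u ∞₀
    Av = doubleAscents ∞₀ v ∞₀
    ε = 𝟙 (doubleDescentAt f (null u) (null v))
    δ = 𝟙 (descentAt f (null u) (null v))
    η = 𝟙 (doubleAscentAt f (null u) (null v))

factors-at-end : ∀ t → t ^ 1 + t ^ 0 ≡ γMonomial t 1 1 0 + γMonomial t 0 0 1
factors-at-end = solve 1 (λ t → t :* con 1 :+ con 1 := con 0 :* (t :* con 1 :* con 1) :+ con 1 :* (con 1 :* ((con 1 :+ t) :* con 1))) refl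

factors-at-end′ : ∀ t → t ^ 0 + t ^ 1 ≡ γMonomial t 0 0 1 + γMonomial t 1 1 0
factors-at-end′ t = trans (+-comm 1 (t ^ 1)) (trans (factors-at-end t) (+-comm (γMonomial t 1 1 0) _))

factors-inside : ∀ t → t ^ 1 + t ^ 1 ≡ γMonomial t 0 1 0 + γMonomial t 0 1 0
factors-inside t = cong₂ _+_ t¹≡ t¹≡
  where t¹≡ = sym (trans (+-identityʳ (t ^ 1 * 1)) (*-identityʳ (t ^ 1)))

desFactor-γFactor : ∀ t f nu nv → desFactor t f nu nv + desFactor t f nv nu ≡ γFactor t f nu nv + γFactor t f nv nu
desFactor-γFactor t true  true  true  = refl
desFactor-γFactor t true  true  false = factors-at-end t
desFactor-γFactor t true  false true  = factors-at-end′ t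
desFactor-γFactor t true  false false = factors-inside t
desFactor-γFactor t false true  true  = factors-inside t
desFactor-γFactor t false true  false = factors-at-end′ t
desFactor-γFactor t false false true  = factors-at-end t
desFactor-γFactor t false false false = refl

nearer-or-nearer : ∀ f x M → Comparable x M → Nearer f x M ⊎ Nearer f M x
nearer-or-nearer true  x M (above x≻M _) = inj₁ x≻M
nearer-or-nearer true  x M (below _ M≻x) = inj₂ M≻x
nearer-or-nearer false x M (above x≻M _) = inj₂ x≻M
nearer-or-nearer false x M (below _ M≻x) = inj₁ M≻x

Nearer-trans : ∀ f x M y → Nearer f x M → Nearer f M y → Nearer f x y
Nearer-trans true  x M y x≻M M≻y = ≻-trans x M y x≻M M≻y
Nearer-trans false x M y M≻x y≻M = ≻-trans y M x y≻M M≻x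

extractNearest : ∀ f x xs → Unique (x ∷ xs) →
  Σ XEntry λ M → Σ (List XEntry) λ X′ → (x ∷ xs ↭ M ∷ X′) × All (Nearer f M) X′
extractNearest f x []       _                  = x , [] , ↭-refl , []
extractNearest f x (y ∷ ys) (x∉y∷ys ∷ y∷ys-unique) with extractNearest f y ys y∷ys-unique
... | M , X′ , π , M-nearer with nearer-or-nearer f x M (comparable x M (All.head (All-resp-↭ π x∉y∷ys)))
...   | inj₁ x-nearer = x , y ∷ ys , ↭-refl ,
          All-resp-↭ (↭-sym π) (x-nearer ∷ All.map (Nearer-trans f x M _ x-nearer) M-nearer)
...   | inj₂ M-nearer-x = M , x ∷ X′ , ↭-trans (↭-prep x π) (↭-swap x M ↭-refl) , M-nearer-x ∷ M-nearer

-- Every permutation of X is u ++ M ∷ v for the entry M of X nearest the walls; the local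
-- contribution of M depends only on whether u and v are empty, and symmetrising over the swap
-- of the parts U, V of X′ turns desFactor into γFactor.
γ-expansion : ∀ f t n (X : List XEntry) → length X ≤ n → All (OnSide f) X → Unique X →
  ∑ (permutations X) (desWeight t ∞₀) ≡ ∑ (permutations X) (γWeight t ∞₀ ∞₀)
γ-expansion f t n       []       _            _  _      = refl
γ-expansion f t (suc n) (x ∷ xs) (s≤s |xs|≤n) on unique with extractNearest f x xs unique
... | M , X′ , π , M-nearer = begin
    ∑ (permutations (x ∷ xs)) (desWeight t ∞₀)
  ≡⟨ trans (∑-permutations-↭ π _) (∑-permutations-around M X′ _) ⟩
    ∑ (bipartitions X′) (uncurry (overPermutations (λ u v → desWeight t ∞₀ (u ++ M ∷ v))))
  ≡⟨ ∑-cong-All (All.map desWeight-part (bipartitions-↭ X′)) ⟩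
    ∑ (bipartitions X′) (λ (U , V) → desFactor t f (null U) (null V) * h U V)
  ≡⟨ ∑-bipartitions-symmetric X′ (λ U V → desFactor t f (null U) (null V)) (λ U V → γFactor t f (null U) (null V)) h
       (λ U V → desFactor-γFactor t f (null U) (null V)) (λ U V → *-comm (∑ (permutations U) (γWeight t ∞₀ ∞₀)) _) ⟩
    ∑ (bipartitions X′) (λ (U , V) → γFactor t f (null U) (null V) * h U V)
  ≡⟨ ∑-cong-All (All.map γWeight-part (bipartitions-↭ X′)) ⟨
    ∑ (bipartitions X′) (uncurry (overPermutations (λ u v → γWeight t ∞₀ ∞₀ (u ++ M ∷ v))))
  ≡⟨ trans (∑-permutations-↭ π _) (∑-permutations-around M X′ _) ⟨
    ∑ (permutations (x ∷ xs)) (γWeight t ∞₀ ∞₀)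
  ∎
  where
  open ≡-Reasoning
  M∷X′-on = All-resp-↭ π on
  M-on = All.head M∷X′-on
  X′-beyond = All.zip (All.tail M∷X′-on , M-nearer)
  X′-unique = AllPairs.tail (Unique-↭ π unique)
  |X′|≤n = ≤-trans (≤-reflexive (suc-injective (sym (↭-length π)))) |xs|≤n

  h : List XEntry → List XEntry → ℕ
  h U V = ∑ (permutations U) (γWeight t ∞₀ ∞₀) * ∑ (permutations V) (γWeight t ∞₀ ∞₀)

  module Part (U V : List XEntry) (ρ : U ++ V ↭ X′) where
    beyond = All-++-↭ U V ρ X′-beyond
    beyond-↭ᵁ : ∀ {u} → u ↭ U → All (Beyond f M) u
    beyond-↭ᵁ πu = All-resp-↭ (↭-sym πu) (proj₁ beyond)
    beyond-↭ⱽ : ∀ {v} → v ↭ V → All (Beyond f M) v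
    beyond-↭ⱽ πv = All-resp-↭ (↭-sym πv) (proj₂ beyond)
    expansion : ∀ {W} → length W ≤ length X′ → All (Beyond f M) W → Unique W →
      ∑ (permutations W) (desWeight t ∞₀) ≡ ∑ (permutations W) (γWeight t ∞₀ ∞₀)
    expansion |W| W-beyond W-unique = γ-expansion f t n _ (≤-trans |W| |X′|≤n) (All.map proj₁ W-beyond) W-unique
    expansionᵁ = expansion (proj₁ (length-++-↭ U V ρ)) (proj₁ beyond) (proj₁ (Unique-++-↭ U V ρ X′-unique))
    expansionⱽ = expansion (proj₂ (length-++-↭ U V ρ)) (proj₂ beyond) (proj₂ (Unique-++-↭ U V ρ X′-unique))

  desWeight-part : ∀ {U V} → U ++ V ↭ X′ →
    overPermutations (λ u v → desWeight t ∞₀ (u ++ M ∷ v)) U V ≡ desFactor t f (null U) (null V) * h U V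
  desWeight-part {U} {V} ρ =
    trans (overPermutations-factor _ (desWeight t ∞₀) (desWeight t ∞₀) (desFactor t f (null U) (null V))
             (λ {u} {v} πu πv → trans (desWeight-around f M M-on u v (beyond-↭ᵁ πu) (beyond-↭ⱽ πv) t)
                                      (cong₂ (λ a b → desFactor t f a b * _) (null-↭ πu) (null-↭ πv))))
      (cong (desFactor t f (null U) (null V) *_) (cong₂ _*_ expansionᵁ expansionⱽ))
    where open Part U V ρ

  γWeight-part : ∀ {U V} → U ++ V ↭ X′ →
    overPermutations (λ u v → γWeight t ∞₀ ∞₀ (u ++ M ∷ v)) U V ≡ γFactor t f (null U) (null V) * h U V
  γWeight-part {U} {V} ρ = overPermutations-factor _ (γWeight t ∞₀ ∞₀) (γWeight t ∞₀ ∞₀) (γFactor t f (null U) (null V))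
    (λ {u} {v} πu πv → trans (γWeight-around f M M-on u v (beyond-↭ᵁ πu) (beyond-↭ⱽ πv) t)
                             (cong₂ (λ a b → γFactor t f a b * _) (null-↭ πu) (null-↭ πv)))
    where open Part U V ρ

-- Alternating runs of low and high entries

-- An entry is low, i.e. below ∞₀, exactly when its colour is 0.
low : XEntry → Bool
low x = ∞₀ ≻ x

agree : Bool → Bool → Bool
agree f b = if f then b else not b

onSide : Bool → XEntry → Bool
onSide f x = agree f (low x)

agree-not : ∀ f b → agree (not f) b ≡ not (agree f b)
agree-not true  b = refl
agree-not false b = sym (not-involutive b)

agree-true : ∀ f b → agree f b ≡ true → b ≡ f
agree-true true  b     b≡true = b≡true
agree-true false false _      = refl

agree-false : ∀ f b → agree f b ≡ false → b ≡ not f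
agree-false true  b    b≡false = b≡false
agree-false false true _       = refl

Walled : XEntry → XEntry → Set
Walled R x = ((∞₀ ≻ x) ≡ true × (R ≻ x) ≡ true) ⊎ ((x ≻ ∞₀) ≡ true × (x ≻ R) ≡ true)

walled-high : ∀ {R} y → Walled R y → low y ≡ false → (y ≻ ∞₀) ≡ true × (y ≻ R) ≡ true
walled-high y (inj₁ (∞₀≻y , _)) y-high = ⊥-elim (true≢false (trans (sym ∞₀≻y) y-high))
walled-high y (inj₂ y≻walls)    _      = y≻walls

walled⇒OnSide : ∀ {R} f y → Walled R y → onSide f y ≡ true → OnSide f y
walled⇒OnSide true  y _ y-low  = y-low
walled⇒OnSide false y w y-high = proj₁ (walled-high y w (agree-true false (low y) y-high))

walled⇒interchangeable : ∀ {R} y → Walled R y → Interchangeable R ∞₀ y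
walled⇒interchangeable {R} y (inj₁ (∞₀≻y , R≻y)) = trans (≻-asym R y R≻y) (sym (≻-asym ∞₀ y ∞₀≻y)) , trans R≻y (sym ∞₀≻y)
walled⇒interchangeable {R} y (inj₂ (y≻∞₀ , y≻R)) = trans y≻R (sym y≻∞₀) , trans (≻-asym y R y≻R) (sym (≻-asym y ∞₀ y≻∞₀))

opposite⇒interchangeable : ∀ {R} y z → Walled R y → Walled R z → low y ≡ not (low z) → Interchangeable z ∞₀ y
opposite⇒interchangeable y z (inj₁ (∞₀≻y , _)) (inj₂ (z≻∞₀ , _)) _ =
  trans (≻-asym z y z≻y) (sym (≻-asym ∞₀ y ∞₀≻y)) , trans z≻y (sym ∞₀≻y)
  where z≻y = ≻-trans z ∞₀ y z≻∞₀ ∞₀≻y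
opposite⇒interchangeable y z (inj₂ (y≻∞₀ , _)) (inj₁ (∞₀≻z , _)) _ =
  trans y≻z (sym y≻∞₀) , trans (≻-asym y z y≻z) (sym (≻-asym y ∞₀ y≻∞₀))
  where y≻z = ≻-trans y ∞₀ z y≻∞₀ ∞₀≻z
opposite⇒interchangeable y z (inj₁ (∞₀≻y , _)) (inj₁ (∞₀≻z , _)) opposite =
  ⊥-elim (true≢false (trans (sym ∞₀≻y) (trans opposite (cong not ∞₀≻z))))
opposite⇒interchangeable y z (inj₂ (y≻∞₀ , _)) (inj₂ (z≻∞₀ , _)) opposite =
  ⊥-elim (true≢false (sym (trans (sym (≻-asym y ∞₀ y≻∞₀)) (trans opposite (cong not (≻-asym z ∞₀ z≻∞₀))))))

opposite-sides : ∀ f y z → onSide f y ≡ true → onSide f z ≡ false → low y ≡ not (low z)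
opposite-sides f y z y-on z-off = trans (agree-true f (low y) y-on) (≡not-sym (agree-false f (low z) z-off))

record FirstRun (R : XEntry) (f : Bool) (b c : List XEntry) : Set where
  field
    b-walled : All (Walled R) b
    c-walled : All (Walled R) c
    b-on     : All (λ y → onSide f y ≡ true) b
    c-off    : OnHead (λ z → onSide f z ≡ false) c

module _ {R : XEntry} {f : Bool} where

  run-wallʳ : ∀ {b c} → FirstRun R f b c → All (Interchangeable (headOr c R) ∞₀) b
  run-wallʳ {b} {[]}    run = All.map (λ {y} → walled⇒interchangeable y) (FirstRun.b-walled run)
  run-wallʳ {b} {z ∷ c} run with FirstRun.c-walled run
  ... | wz ∷ _ = All.zipWith (λ {y} (wy , y-on) → opposite⇒interchangeable y z wy wz (opposite-sides f y z y-on (FirstRun.c-off run)))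
                   (FirstRun.b-walled run , FirstRun.b-on run)

  run-wallˡ : ∀ {b c} → FirstRun R f b c → OnHead (Interchangeable (lastOr ∞₀ b) ∞₀) c
  run-wallˡ {b}     {[]}    run = tt
  run-wallˡ {[]}    {z ∷ c} run = refl , refl
  run-wallˡ {y ∷ b} {z ∷ c} run with FirstRun.b-walled run | FirstRun.b-on run | FirstRun.c-walled run
  ... | wy ∷ wb | y-on ∷ b-on | wz ∷ _ =
    opposite⇒interchangeable z (lastOr y b) wz (lastOr-All y b wy wb)
      (≡not-sym (opposite-sides f (lastOr y b) z (lastOr-All {P = λ x → onSide f x ≡ true} y b y-on b-on) (FirstRun.c-off run)))

  module _ {b c} (run : FirstRun R f b c) where

    descents-run : descents (b ++ c) R ≡ descents b ∞₀ + descents c R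
    descents-run = trans (descents-++ b c R) (cong (_+ descents c R) (descents-wallʳ b (headOr c R) ∞₀ (run-wallʳ run)))

    doubleDescents-run : doubleDescents ∞₀ (b ++ c) R ≡ doubleDescents ∞₀ b ∞₀ + doubleDescents ∞₀ c R
    doubleDescents-run = trans (doubleDescents-++ ∞₀ b c R)
      (cong₂ _+_ (doubleDescents-wallʳ ∞₀ b (headOr c R) ∞₀ (run-wallʳ run))
                 (doubleDescents-wallˡ (lastOr ∞₀ b) ∞₀ c R (run-wallˡ run)))

    doubleAscents-run : doubleAscents ∞₀ (b ++ c) R ≡ doubleAscents ∞₀ b ∞₀ + doubleAscents ∞₀ c R
    doubleAscents-run = trans (doubleAscents-++ ∞₀ b c R)
      (cong₂ _+_ (doubleAscents-wallʳ ∞₀ b (headOr c R) ∞₀ (run-wallʳ run))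
                 (doubleAscents-wallˡ (lastOr ∞₀ b) ∞₀ c R (run-wallˡ run)))

    desWeight-run : ∀ t → desWeight t R (b ++ c) ≡ desWeight t ∞₀ b * desWeight t R c
    desWeight-run t = trans (cong (t ^_) descents-run) (^-distribˡ-+-* t (descents b ∞₀) (descents c R))

    γWeight-run : ∀ t → γWeight t ∞₀ R (b ++ c) ≡ γWeight t ∞₀ ∞₀ b * γWeight t ∞₀ R c
    γWeight-run t = begin
        γMonomial t (doubleDescents ∞₀ (b ++ c) R) (descents (b ++ c) R) (doubleAscents ∞₀ (b ++ c) R)
      ≡⟨ cong₂ (λ e d → γMonomial t e d (doubleAscents ∞₀ (b ++ c) R)) doubleDescents-run descents-run ⟩
        γMonomial t (Eb + Ec) (Db + Dc) (doubleAscents ∞₀ (b ++ c) R)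
      ≡⟨ cong (γMonomial t (Eb + Ec) (Db + Dc)) doubleAscents-run ⟩
        γMonomial t (Eb + Ec) (Db + Dc) (Ab + Ac)
      ≡⟨ γMonomial-+ t Eb Ec Db Dc Ab Ac ⟩
        γMonomial t Eb Db Ab * γMonomial t Ec Dc Ac
      ∎
      where
      open ≡-Reasoning
      Eb = doubleDescents ∞₀ b ∞₀
      Ec = doubleDescents ∞₀ c R
      Db = descents b ∞₀
      Dc = descents c R
      Ab = doubleAscents ∞₀ b ∞₀
      Ac = doubleAscents ∞₀ c R

endWeight : Bool → (List XEntry → ℕ) → List XEntry → ℕ
endWeight ℓ W w = 𝟙 (lastIs (onSide ℓ) w) * W w

restWeight : Bool → Bool → (List XEntry → ℕ) → List XEntry → ℕ
restWeight f ℓ W c = 𝟙 (not (headIs (onSide f) c)) * (𝟙 (if null c then agree ℓ f else lastIs (onSide ℓ) c) * W c)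

nonemptyRun : Bool → List XEntry → Bool
nonemptyRun f B = not (null B) ∧ allᵇ (onSide f) B

lastIs-run : ∀ f ℓ b → null b ≡ false → All (λ y → onSide f y ≡ true) b → lastIs (onSide ℓ) b ≡ agree ℓ f
lastIs-run f ℓ (y ∷ b) _ (y-on ∷ b-on) =
  cong (agree ℓ) (agree-true f _ (lastOr-All {P = λ x → onSide f x ≡ true} y b y-on b-on))

module _ (R : XEntry) (f ℓ : Bool) (W Wᵇ : List XEntry → ℕ)
         (W-run : ∀ {b c} → FirstRun R f b c → W (b ++ c) ≡ Wᵇ b * W c) where

  firstRun-term : ∀ {B C b c} → b ↭ B → c ↭ C → All (Walled R) b → All (Walled R) c →
    𝟙 (isFirstRun (onSide f) b c) * endWeight ℓ W (b ++ c) ≡ 𝟙 (nonemptyRun f B) * (Wᵇ b * restWeight f ℓ W c)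
  firstRun-term {B} {C} {b} {c} πb πc b-walled c-walled = begin
      𝟙 (isFirstRun (onSide f) b c) * endWeight ℓ W (b ++ c)
    ≡⟨ cong (λ k → 𝟙 k * endWeight ℓ W (b ++ c)) isFirstRun≡ ⟩
      𝟙 (nonemptyRun f B ∧ not (headIs (onSide f) c)) * endWeight ℓ W (b ++ c)
    ≡⟨ 𝟙-∧-guard (nonemptyRun f B) (not (headIs (onSide f) c)) {z = Wᵇ b} factor ⟩
      𝟙 (nonemptyRun f B) * (Wᵇ b * restWeight f ℓ W c)
    ∎
    where
    open ≡-Reasoning
    isFirstRun≡ : isFirstRun (onSide f) b c ≡ nonemptyRun f B ∧ not (headIs (onSide f) c)
    isFirstRun≡ = trans (sym (∧-assoc (not (null b)) _ _))
      (cong₂ (λ n a → (not n ∧ a) ∧ not (headIs (onSide f) c)) (null-↭ πb) (allᵇ-↭ (onSide f) πb))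
    c-off : ∀ c → not (headIs (onSide f) c) ≡ true → OnHead (λ z → onSide f z ≡ false) c
    c-off []      _ = tt
    c-off (z ∷ _) q = not≡true q
    factor : nonemptyRun f B ≡ true → not (headIs (onSide f) c) ≡ true →
      endWeight ℓ W (b ++ c) ≡ Wᵇ b * (𝟙 (if null c then agree ℓ f else lastIs (onSide ℓ) c) * W c)
    factor nonempty q = begin
        𝟙 (lastIs (onSide ℓ) (b ++ c)) * W (b ++ c)
      ≡⟨ cong₂ (λ L w → 𝟙 L * w) (lastIs-++ (onSide ℓ) b c) (W-run run) ⟩
        𝟙 (if null c then lastIs (onSide ℓ) b else lastIs (onSide ℓ) c) * (Wᵇ b * W c)
      ≡⟨ cong (λ L → 𝟙 (if null c then L else lastIs (onSide ℓ) c) * (Wᵇ b * W c)) (lastIs-run f ℓ b b-nonempty b-on) ⟩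
        𝟙 (if null c then agree ℓ f else lastIs (onSide ℓ) c) * (Wᵇ b * W c)
      ≡⟨ x∙yz≈y∙xz (𝟙 (if null c then agree ℓ f else lastIs (onSide ℓ) c)) (Wᵇ b) (W c) ⟩
        Wᵇ b * (𝟙 (if null c then agree ℓ f else lastIs (onSide ℓ) c) * W c)
      ∎
      where
      b-nonempty = trans (null-↭ πb) (not≡true (∧-conicalˡ (not (null B)) _ nonempty))
      b-on = allᵇ⇒All (onSide f) b (trans (allᵇ-↭ (onSide f) πb) (∧-conicalʳ (not (null B)) _ nonempty))
      run : FirstRun R f b c
      run = record { b-walled = b-walled ; c-walled = c-walled ; b-on = b-on ; c-off = c-off c q }

  overPermutations-firstRun : ∀ {B C} → All (Walled R) B → All (Walled R) C →
    overPermutations (λ b c → 𝟙 (isFirstRun (onSide f) b c) * endWeight ℓ W (b ++ c)) B C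
      ≡ 𝟙 (nonemptyRun f B) * (∑ (permutations B) Wᵇ * ∑ (permutations C) (restWeight f ℓ W))
  overPermutations-firstRun {B} B-walled C-walled = overPermutations-factor _ Wᵇ (restWeight f ℓ W) (𝟙 (nonemptyRun f B))
    (λ πb πc → firstRun-term πb πc (All-resp-↭ (↭-sym πb) B-walled) (All-resp-↭ (↭-sym πc) C-walled))

restWeight-∷ : ∀ f ℓ W {c z zs} → c ↭ z ∷ zs → restWeight f ℓ W c ≡ 𝟙 (headIs (onSide (not f)) c) * endWeight ℓ W c
restWeight-∷ f ℓ W {[]}    π with () ← ↭-length π
restWeight-∷ f ℓ W {y ∷ c} _ = cong (λ a → 𝟙 a * endWeight ℓ W (y ∷ c)) (sym (agree-not f (low y)))

-- A permutation starting on side f is its maximal first run b, which lies between two walls ∞₀,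
-- followed by a rest c that starts on the other side and is expanded recursively.
γ-expansion-walled : ∀ t R n (X : List XEntry) → length X ≤ n → All (Walled R) X → Unique X → ∀ f ℓ →
  ∑ (permutations X) (λ w → 𝟙 (headIs (onSide f) w) * endWeight ℓ (desWeight t R) w)
    ≡ ∑ (permutations X) (λ w → 𝟙 (headIs (onSide f) w) * endWeight ℓ (γWeight t ∞₀ R) w)
γ-expansion-walled t R zero    [] _ _ _ f ℓ = refl
γ-expansion-walled t R (suc n) X |X|≤1+n X-walled X-unique f ℓ = begin
    ∑ (permutations X) (λ w → 𝟙 (headIs (onSide f) w) * endWeight ℓ (desWeight t R) w)
  ≡⟨ ∑-permutations-firstRun (onSide f) X _ ⟩
    ∑ (bipartitions X) (uncurry (overPermutations (λ b c → 𝟙 (isFirstRun (onSide f) b c) * endWeight ℓ (desWeight t R) (b ++ c))))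
  ≡⟨ ∑-cong-All (All.map (λ {(B , C)} → blocks B C) (bipartitions-↭ X)) ⟩
    ∑ (bipartitions X) (uncurry (overPermutations (λ b c → 𝟙 (isFirstRun (onSide f) b c) * endWeight ℓ (γWeight t ∞₀ R) (b ++ c))))
  ≡⟨ ∑-permutations-firstRun (onSide f) X _ ⟨
    ∑ (permutations X) (λ w → 𝟙 (headIs (onSide f) w) * endWeight ℓ (γWeight t ∞₀ R) w)
  ∎
  where
  open ≡-Reasoning
  rest-expansion : ∀ C → length C ≤ n → All (Walled R) C → Unique C →
    ∑ (permutations C) (restWeight f ℓ (desWeight t R)) ≡ ∑ (permutations C) (restWeight f ℓ (γWeight t ∞₀ R))
  rest-expansion []       _   _        _        = refl
  rest-expansion (z ∷ zs) |C| C-walled C-unique = begin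
      ∑ (permutations (z ∷ zs)) (restWeight f ℓ (desWeight t R))
    ≡⟨ ∑-cong-All (All.map (restWeight-∷ f ℓ (desWeight t R)) (permutations-↭ (z ∷ zs))) ⟩
      ∑ (permutations (z ∷ zs)) (λ w → 𝟙 (headIs (onSide (not f)) w) * endWeight ℓ (desWeight t R) w)
    ≡⟨ γ-expansion-walled t R n (z ∷ zs) |C| C-walled C-unique (not f) ℓ ⟩
      ∑ (permutations (z ∷ zs)) (λ w → 𝟙 (headIs (onSide (not f)) w) * endWeight ℓ (γWeight t ∞₀ R) w)
    ≡⟨ ∑-cong-All (All.map (restWeight-∷ f ℓ (γWeight t ∞₀ R)) (permutations-↭ (z ∷ zs))) ⟨
      ∑ (permutations (z ∷ zs)) (restWeight f ℓ (γWeight t ∞₀ R))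
    ∎

  blocks : ∀ B C → B ++ C ↭ X →
    overPermutations (λ b c → 𝟙 (isFirstRun (onSide f) b c) * endWeight ℓ (desWeight t R) (b ++ c)) B C
      ≡ overPermutations (λ b c → 𝟙 (isFirstRun (onSide f) b c) * endWeight ℓ (γWeight t ∞₀ R) (b ++ c)) B C
  blocks B C ρ = begin
      _
    ≡⟨ overPermutations-firstRun R f ℓ (desWeight t R) (desWeight t ∞₀) (λ run → desWeight-run run t) B-walled C-walled ⟩
      𝟙 (nonemptyRun f B) * (∑ (permutations B) (desWeight t ∞₀) * ∑ (permutations C) (restWeight f ℓ (desWeight t R)))
    ≡⟨ 𝟙-guard-cong (nonemptyRun f B) (λ nonempty → cong₂ _*_ (run-expansion nonempty) (rest-expansion C (|C|≤n nonempty) C-walled C-unique)) ⟩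
      𝟙 (nonemptyRun f B) * (∑ (permutations B) (γWeight t ∞₀ ∞₀) * ∑ (permutations C) (restWeight f ℓ (γWeight t ∞₀ R)))
    ≡⟨ overPermutations-firstRun R f ℓ (γWeight t ∞₀ R) (γWeight t ∞₀ ∞₀) (λ run → γWeight-run run t) B-walled C-walled ⟨
      _
    ∎
    where
    B-walled = proj₁ (All-++-↭ B C ρ X-walled)
    C-walled = proj₂ (All-++-↭ B C ρ X-walled)
    B-unique = proj₁ (Unique-++-↭ B C ρ X-unique)
    C-unique = proj₂ (Unique-++-↭ B C ρ X-unique)
    run-expansion : nonemptyRun f B ≡ true → ∑ (permutations B) (desWeight t ∞₀) ≡ ∑ (permutations B) (γWeight t ∞₀ ∞₀)
    run-expansion nonempty = γ-expansion f t (length B) B ≤-refl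
      (All.zipWith (λ {y} (wy , y-on) → walled⇒OnSide f y wy y-on) (B-walled , allᵇ⇒All (onSide f) B (∧-conicalʳ _ _ nonempty)))
      B-unique
    |C|≤n : nonemptyRun f B ≡ true → length C ≤ n
    |C|≤n nonempty = length-++-↭-rest B C ρ |X|≤1+n (not≡true (∧-conicalˡ _ _ nonempty))

-- Slides

long : List XEntry → Bool
long b = 2 ≤ᵇ length b

segmentCount : XEntry → List XEntry → ℕ
segmentCount x xs = length (filterᵇ long (segments x xs))

interiorDoubleDescents : XEntry → List XEntry → ℕ
interiorDoubleDescents x []           = 0
interiorDoubleDescents x (y ∷ [])     = 0
interiorDoubleDescents x (y ∷ z ∷ zs) = 𝟙 ((x ≻ y) ∧ (y ≻ z)) + interiorDoubleDescents y (z ∷ zs)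

segmentsStep : XEntry → XEntry → List XEntry → Bool → List (List XEntry)
segmentsStep y z zs y≺z = if y≺z then (y ∷ []) ∷ segments z zs else consHead y (segments z zs)

first-segment : ∀ y ys → Linked Comparable (y ∷ ys) →
  Σ (List XEntry) λ rest → Σ (List (List XEntry)) λ bs →
    (segments y ys ≡ (y ∷ rest) ∷ bs) × (null rest ≡ not (headIs (y ≻_) ys))
first-segment y []       [-]                   = [] , [] , refl , refl
first-segment y (z ∷ zs) (below y⊁z z≻y ∷ _)   = [] , segments z zs , cong (segmentsStep y z zs) z≻y , cong not (sym y⊁z)
first-segment y (z ∷ zs) (above y≻z z⊁y ∷ zs-linked) with first-segment z zs zs-linked
... | rest , bs , segs , _ =
  z ∷ rest , bs , trans (cong (segmentsStep y z zs) z⊁y) (cong (consHead y) segs) , cong not (sym y≻z)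

interiorDoubleDescents-∷ : ∀ x y ys →
  interiorDoubleDescents x (y ∷ ys) ≡ 𝟙 ((x ≻ y) ∧ headIs (y ≻_) ys) + interiorDoubleDescents y ys
interiorDoubleDescents-∷ x y []       = cong (λ b → 𝟙 b + 0) (sym (∧-zeroʳ (x ≻ y)))
interiorDoubleDescents-∷ x y (z ∷ zs) = refl

long-∷ : ∀ y rest → long (y ∷ rest) ≡ not (null rest)
long-∷ y []      = refl
long-∷ y (_ ∷ _) = refl

segmentCount+interiorDoubleDescents : ∀ x xs → Linked Comparable (x ∷ xs) →
  segmentCount x xs + interiorDoubleDescents x xs ≡ countDesc (x ∷ xs)
segmentCount+interiorDoubleDescents x []       [-] = refl
segmentCount+interiorDoubleDescents x (y ∷ ys) (below x⊁y y≻x ∷ linked) = begin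
    length (filterᵇ long (segments x (y ∷ ys))) + interiorDoubleDescents x (y ∷ ys)
  ≡⟨ cong₂ _+_ (cong (length ∘ filterᵇ long) (cong (segmentsStep x y ys) y≻x))
               (trans (interiorDoubleDescents-∷ x y ys) (cong (λ b → 𝟙 (b ∧ headIs (y ≻_) ys) + _) x⊁y)) ⟩
    segmentCount y ys + interiorDoubleDescents y ys
  ≡⟨ segmentCount+interiorDoubleDescents y ys linked ⟩
    countDesc (y ∷ ys)
  ≡⟨ cong (λ b → 𝟙 b + countDesc (y ∷ ys)) x⊁y ⟨
    countDesc (x ∷ y ∷ ys)
  ∎
  where open ≡-Reasoning
segmentCount+interiorDoubleDescents x (y ∷ ys) (above x≻y y⊁x ∷ linked)
  with first-segment y ys linked | segmentCount+interiorDoubleDescents y ys linked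
... | rest , bs , segs , rest-null | ih = begin
    length (filterᵇ long (segments x (y ∷ ys))) + interiorDoubleDescents x (y ∷ ys)
  ≡⟨ cong₂ _+_ (cong (length ∘ filterᵇ long) (trans (cong (segmentsStep x y ys) y⊁x) (cong (consHead x) segs)))
               (trans (interiorDoubleDescents-∷ x y ys) (cong (λ b → 𝟙 (b ∧ headIs (y ≻_) ys) + _) x≻y)) ⟩
    suc (length (filterᵇ long bs)) + (𝟙 (headIs (y ≻_) ys) + interiorDoubleDescents y ys)
  ≡⟨ cong suc (+-assoc-comm (length (filterᵇ long bs)) (𝟙 (headIs (y ≻_) ys)) _) ⟩
    suc ((𝟙 (headIs (y ≻_) ys) + length (filterᵇ long bs)) + interiorDoubleDescents y ys)
  ≡⟨ cong (λ b → suc ((𝟙 b + length (filterᵇ long bs)) + interiorDoubleDescents y ys))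
          (sym (trans (long-∷ y rest) (trans (cong not rest-null) (not-involutive _)))) ⟩
    suc ((𝟙 (long (y ∷ rest)) + length (filterᵇ long bs)) + interiorDoubleDescents y ys)
  ≡⟨ cong (λ n → suc (n + interiorDoubleDescents y ys)) (length-filterᵇ-∷ long (y ∷ rest) bs) ⟨
    suc (length (filterᵇ long ((y ∷ rest) ∷ bs)) + interiorDoubleDescents y ys)
  ≡⟨ cong (λ s → suc (length (filterᵇ long s) + interiorDoubleDescents y ys)) segs ⟨
    suc (segmentCount y ys + interiorDoubleDescents y ys)
  ≡⟨ cong suc ih ⟩
    suc (countDesc (y ∷ ys))
  ≡⟨ cong (λ b → 𝟙 b + countDesc (y ∷ ys)) x≻y ⟨
    countDesc (x ∷ y ∷ ys)
  ∎
  where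
  open ≡-Reasoning
  +-assoc-comm : ∀ a b c → a + (b + c) ≡ (b + a) + c
  +-assoc-comm a b c = trans (sym (+-assoc a b c)) (cong (_+ c) (+-comm a b))

countDesc-++ : ∀ w b → countDesc (w ++ [ b ]) ≡ descents w b
countDesc-++ []          b = refl
countDesc-++ (x ∷ [])    b = refl
countDesc-++ (x ∷ y ∷ w) b = cong (𝟙 (x ≻ y) +_) (countDesc-++ (y ∷ w) b)

interiorDoubleDescents-++ : ∀ a w b → interiorDoubleDescents a (w ++ [ b ]) ≡ doubleDescents a w b
interiorDoubleDescents-++ a []          b = refl
interiorDoubleDescents-++ a (x ∷ [])    b = refl
interiorDoubleDescents-++ a (x ∷ y ∷ w) b = cong (𝟙 ((a ≻ x) ∧ (x ≻ y)) +_) (interiorDoubleDescents-++ x (y ∷ w) b)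

doubleAscents-balance : ∀ a x xs b → Linked Comparable (a ∷ (x ∷ xs) ++ [ b ]) →
  doubleAscents a (x ∷ xs) b + 2 * descents (x ∷ xs) b + 1
    ≡ doubleDescents a (x ∷ xs) b + length (x ∷ xs) + 𝟙 (x ≻ a) + 𝟙 (lastOr x xs ≻ b)
doubleAscents-balance a x [] b (a∼x ∷ x∼b ∷ [-]) =
  subst₂ (λ p r → 𝟙 ((x ≻ a) ∧ (b ≻ x)) + 0 + 2 * (𝟙 r + 0) + 1 ≡ 𝟙 (p ∧ r) + 0 + 1 + 𝟙 (x ≻ a) + 𝟙 r)
    (sym (Comparable⇒≡not a∼x)) (sym (Comparable⇒≡not x∼b)) (balance (x ≻ a) (b ≻ x))
  where
  balance : ∀ q s → 𝟙 (q ∧ s) + 0 + 2 * (𝟙 (not s) + 0) + 1 ≡ 𝟙 (not q ∧ not s) + 0 + 1 + 𝟙 q + 𝟙 (not s)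
  balance false false = refl
  balance false true  = refl
  balance true  false = refl
  balance true  true  = refl
doubleAscents-balance a x (y ∷ ys) b (a∼x ∷ linked@(x∼y ∷ _)) = begin
    (P + Dx) + 2 * (Q + Dd) + 1
  ≡⟨ solve 4 (λ P Dx Q Dd → (P :+ Dx) :+ con 2 :* (Q :+ Dd) :+ con 1 := (P :+ con 2 :* Q) :+ (Dx :+ con 2 :* Dd :+ con 1)) refl P Dx Q Dd ⟩
    (P + 2 * Q) + (Dx + 2 * Dd + 1)
  ≡⟨ cong ((P + 2 * Q) +_) (doubleAscents-balance x y ys b linked) ⟩
    (P + 2 * Q) + (Ex + n + U + Lb)
  ≡⟨ solve 6 (λ P Q Ex n U Lb → (P :+ con 2 :* Q) :+ (Ex :+ n :+ U :+ Lb) := (P :+ con 2 :* Q :+ U) :+ (Ex :+ n :+ Lb)) refl P Q Ex n U Lb ⟩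
    (P + 2 * Q + U) + (Ex + n + Lb)
  ≡⟨ cong (_+ (Ex + n + Lb)) (local a∼x x∼y) ⟩
    (Rr + 1 + V) + (Ex + n + Lb)
  ≡⟨ solve 5 (λ Rr V Ex n Lb → (Rr :+ con 1 :+ V) :+ (Ex :+ n :+ Lb) := (Rr :+ Ex) :+ (con 1 :+ n) :+ V :+ Lb) refl Rr V Ex n Lb ⟩
    (Rr + Ex) + suc n + V + Lb
  ∎
  where
  open ≡-Reasoning
  P = 𝟙 ((x ≻ a) ∧ (y ≻ x))
  Q = 𝟙 (x ≻ y)
  Rr = 𝟙 ((a ≻ x) ∧ (x ≻ y))
  U = 𝟙 (y ≻ x)
  V = 𝟙 (x ≻ a)
  Dx = doubleAscents x (y ∷ ys) b
  Dd = descents (y ∷ ys) b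
  Ex = doubleDescents x (y ∷ ys) b
  n = length (y ∷ ys)
  Lb = 𝟙 (lastOr y ys ≻ b)
  local : Comparable a x → Comparable x y → P + 2 * Q + U ≡ Rr + 1 + V
  local a∼x x∼y = subst₂ (λ p r → P + 2 * 𝟙 r + U ≡ 𝟙 (p ∧ r) + 1 + V)
    (sym (Comparable⇒≡not a∼x)) (sym (Comparable⇒≡not x∼y)) (balance (x ≻ a) (y ≻ x))
    where
    balance : ∀ q u → 𝟙 (q ∧ u) + 2 * 𝟙 (not u) + 𝟙 u ≡ 𝟙 (not q ∧ not u) + 1 + 𝟙 q
    balance false false = refl
    balance false true  = refl
    balance true  false = refl
    balance true  true  = refl

-- The contribution to gammaSum (n / 2) n of a permutation with i descents and s slides.
γSummand : ℕ → ℕ → ℕ → ℕ → ℕ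
γSummand t n i s = 𝟙 (i <ᵇ suc (n / 2)) * ((𝟙 (s ≡ᵇ suc i) * t ^ i) * (1 + t) ^ (n ∸ 2 * i))

≤/2 : ∀ i n → 2 * i ≤ n → i ≤ n / 2
≤/2 i n 2i≤n = subst (_≤ n / 2) (m*n/n≡m i 2) (/-monoˡ-≤ 2 (subst (_≤ n) (*-comm 2 i) 2i≤n))

γSummand-match : ∀ t n D S E A → S + E ≡ suc D → (E ≡ 0 → A + 2 * D ≡ n) → γSummand t n D S ≡ γMonomial t E D A
γSummand-match t n D S (suc e) A S+E≡1+D _ with S ≡ᵇ suc D in S≟1+D
... | true  = ⊥-elim (m+1+n≢m (suc D) (trans (cong (_+ suc e) (sym (≡ᵇ-true⇒≡ S (suc D) S≟1+D))) S+E≡1+D))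
... | false = *-zeroʳ (𝟙 (D <ᵇ suc (n / 2)))
γSummand-match t n D S zero A S+0≡1+D degree = begin
    𝟙 (D <ᵇ suc (n / 2)) * ((𝟙 (S ≡ᵇ suc D) * t ^ D) * (1 + t) ^ (n ∸ 2 * D))
  ≡⟨ cong₂ (λ a b → 𝟙 a * ((𝟙 b * t ^ D) * (1 + t) ^ (n ∸ 2 * D))) D≤n/2 S≡1+D ⟩
    1 * ((1 * t ^ D) * (1 + t) ^ (n ∸ 2 * D))
  ≡⟨ cong (λ z → 1 * (z * (1 + t) ^ (n ∸ 2 * D))) (*-identityˡ (t ^ D)) ⟩
    1 * (t ^ D * (1 + t) ^ (n ∸ 2 * D))
  ≡⟨ cong (λ z → 1 * (t ^ D * (1 + t) ^ z)) n∸2D≡A ⟩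
    1 * (t ^ D * (1 + t) ^ A)
  ∎
  where
  open ≡-Reasoning
  A+2D≡n = degree refl
  D≤n/2 = T⇒≡true (<⇒<ᵇ (s≤s (≤/2 D n (subst (2 * D ≤_) A+2D≡n (m≤n+m (2 * D) A)))))
  S≡1+D = trans (cong (_≡ᵇ suc D) (trans (sym (+-identityʳ S)) S+0≡1+D)) (≡ᵇ-refl (suc D))
  n∸2D≡A = trans (cong (_∸ 2 * D) (sym A+2D≡n)) (m+n∸n≡m A (2 * D))

rightWall : ℕ → XEntry
rightWall d = (fin (suc d) , 0)

γDegree : Bool → ℕ → ℕ
γDegree true  d = d ∸ 1
γDegree false d = d

walled-last-≻ : ∀ {R} ℓ y → Walled R y → onSide ℓ y ≡ true → (y ≻ R) ≡ not ℓ
walled-last-≻ {R} true  y (inj₁ (_ , R≻y))   _     = ≻-asym R y R≻y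
walled-last-≻     true  y (inj₂ (y≻∞₀ , _)) y-low = ⊥-elim (true≢false (trans (sym y-low) (≻-asym y ∞₀ y≻∞₀)))
walled-last-≻     false y w                  y-high = proj₂ (walled-high y w (not≡true y-high))

module _ (t d : ℕ) (ℓ : Bool) (x : XEntry) (xs : List XEntry)
         (linked : Linked Comparable (∞₀ ∷ (x ∷ xs) ++ [ rightWall d ]))
         (walled : All (Walled (rightWall d)) (x ∷ xs)) (|w|≡d : length (x ∷ xs) ≡ d)
         (x-low : low x ≡ true) (last-on : lastIs (onSide ℓ) (x ∷ xs) ≡ true) where

  private
    R = rightWall d
    w = x ∷ xs

  slides-balance : segmentCount ∞₀ (w ++ [ R ]) + doubleDescents ∞₀ w R ≡ suc (descents w R)
  slides-balance = begin
      segmentCount ∞₀ (w ++ [ R ]) + doubleDescents ∞₀ w R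
    ≡⟨ cong (segmentCount ∞₀ (w ++ [ R ]) +_) (interiorDoubleDescents-++ ∞₀ w R) ⟨
      segmentCount ∞₀ (w ++ [ R ]) + interiorDoubleDescents ∞₀ (w ++ [ R ])
    ≡⟨ segmentCount+interiorDoubleDescents ∞₀ (w ++ [ R ]) linked ⟩
      𝟙 (∞₀ ≻ x) + countDesc (w ++ [ R ])
    ≡⟨ cong₂ (λ b n → 𝟙 b + n) x-low (countDesc-++ w R) ⟩
      suc (descents w R)
    ∎
    where open ≡-Reasoning

  degree-balance : doubleDescents ∞₀ w R ≡ 0 → doubleAscents ∞₀ w R + 2 * descents w R ≡ γDegree ℓ d
  degree-balance no-double-descents = cancel ℓ (begin
      doubleAscents ∞₀ w R + 2 * descents w R + 1
    ≡⟨ doubleAscents-balance ∞₀ x xs R linked ⟩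
      doubleDescents ∞₀ w R + length w + 𝟙 (x ≻ ∞₀) + 𝟙 (lastOr x xs ≻ R)
    ≡⟨ cong₂ (λ e n → e + n + 𝟙 (x ≻ ∞₀) + 𝟙 (lastOr x xs ≻ R)) no-double-descents |w|≡d ⟩
      d + 𝟙 (x ≻ ∞₀) + 𝟙 (lastOr x xs ≻ R)
    ≡⟨ cong₂ (λ a b → d + 𝟙 a + 𝟙 b) (≻-asym ∞₀ x x-low) (walled-last-≻ ℓ (lastOr x xs) last-walled last-on) ⟩
      d + 0 + 𝟙 (not ℓ)
    ∎)
    where
    open ≡-Reasoning
    last-walled = lastOr-All x xs (All.head walled) (All.tail walled)
    cancel : ∀ ℓ {m} → m + 1 ≡ d + 0 + 𝟙 (not ℓ) → m ≡ γDegree ℓ d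
    cancel true  {m} m+1≡d = trans (sym (m+n∸n≡m m 1)) (cong (_∸ 1) (trans m+1≡d (trans (+-identityʳ (d + 0)) (+-identityʳ d))))
    cancel false {m} m+1≡d+1 = +-cancelʳ-≡ 1 m d (trans m+1≡d+1 (cong (_+ 1) (+-identityʳ d)))

  γSummand≡γWeight : γSummand t (γDegree ℓ d) (descents w R) (segmentCount ∞₀ (w ++ [ R ])) ≡ γWeight t ∞₀ R w
  γSummand≡γWeight = γSummand-match t (γDegree ℓ d) (descents w R) (segmentCount ∞₀ (w ++ [ R ]))
    (doubleDescents ∞₀ w R) (doubleAscents ∞₀ w R)
    slides-balance degree-balance

-- Words with distinct keys and colour choices

∑-words-∷ : {A : Set} (n : ℕ) (L : List A) (H : List A → ℕ) →
  ∑ (words (suc n) L) H ≡ ∑ L (λ a → ∑ (words n L) (H ∘ (a ∷_)))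
∑-words-∷ n L H = trans (∑-concatMap _ L H) (∑-cong L (λ a → ∑-map (a ∷_) (words n L) H))

∑-words-allᵇ : {A : Set} (n : ℕ) (L : List A) (p : A → Bool) (H : List A → ℕ) →
  ∑ (words n L) (λ w → 𝟙 (allᵇ p w) * H w) ≡ ∑ (words n (filterᵇ p L)) H
∑-words-allᵇ zero    L p H = cong (_+ 0) (+-identityʳ (H []))
∑-words-allᵇ (suc n) L p H = begin
    ∑ (words (suc n) L) (λ w → 𝟙 (allᵇ p w) * H w)
  ≡⟨ ∑-words-∷ n L _ ⟩
    ∑ L (λ a → ∑ (words n L) (λ w → 𝟙 (p a ∧ allᵇ p w) * H (a ∷ w)))
  ≡⟨ ∑-cong L (λ a → trans (∑-cong (words n L) (λ w → split a w)) (∑-*ˡ (words n L) (𝟙 (p a)) _)) ⟩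
    ∑ L (λ a → 𝟙 (p a) * ∑ (words n L) (λ w → 𝟙 (allᵇ p w) * H (a ∷ w)))
  ≡⟨ ∑-cong L (λ a → cong (𝟙 (p a) *_) (∑-words-allᵇ n L p (H ∘ (a ∷_)))) ⟩
    ∑ L (λ a → 𝟙 (p a) * ∑ (words n (filterᵇ p L)) (H ∘ (a ∷_)))
  ≡⟨ ∑-filterᵇ p L _ ⟨
    ∑ (filterᵇ p L) (λ a → ∑ (words n (filterᵇ p L)) (H ∘ (a ∷_)))
  ≡⟨ ∑-words-∷ n (filterᵇ p L) H ⟨
    ∑ (words (suc n) (filterᵇ p L)) H
  ∎
  where
  open ≡-Reasoning
  split : ∀ a w → 𝟙 (p a ∧ allᵇ p w) * H (a ∷ w) ≡ 𝟙 (p a) * (𝟙 (allᵇ p w) * H (a ∷ w))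
  split a w = trans (cong (_* H (a ∷ w)) (𝟙-∧ (p a) (allᵇ p w))) (*-assoc (𝟙 (p a)) _ _)

lettersOf : ℕ → List ℕ → List Entry
lettersOf r K = concatMap (λ v → map (v ,_) (upTo r)) K

colourChoices : ℕ → List ℕ → List (List Entry)
colourChoices r []      = [ [] ]
colourChoices r (k ∷ K) = concatMap (λ c → map ((k , c) ∷_) (colourChoices r K)) (upTo r)

removeKey : ℕ → List ℕ → List ℕ
removeKey k K = filterᵇ (λ v → not (k ≡ᵇ v)) K

∑-colourChoices-∷ : ∀ r k K (H : List Entry → ℕ) →
  ∑ (colourChoices r (k ∷ K)) H ≡ ∑ (upTo r) (λ c → ∑ (colourChoices r K) (H ∘ ((k , c) ∷_)))
∑-colourChoices-∷ r k K H = trans (∑-concatMap _ (upTo r) H) (∑-cong (upTo r) (λ c → ∑-map ((k , c) ∷_) (colourChoices r K) H))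

colourChoices-keys : ∀ r K → All (λ ch → map proj₁ ch ≡ K) (colourChoices r K)
colourChoices-keys r []      = refl ∷ []
colourChoices-keys r (k ∷ K) =
  concat⁺ (map⁺ (All.universal (λ c → map⁺ (All.map (cong (k ∷_)) (colourChoices-keys r K))) (upTo r)))

notElem-keys : ∀ k (w : List Entry) → notElem k (map proj₁ w) ≡ allᵇ (λ y → not (k ≡ᵇ proj₁ y)) w
notElem-keys k []      = refl
notElem-keys k (y ∷ w) = cong (not (k ≡ᵇ proj₁ y) ∧_) (notElem-keys k w)

filterᵇ-const : {A : Set} (p : A → Bool) (xs : List A) (b : Bool) → All (λ x → p x ≡ b) xs →
  filterᵇ p xs ≡ (if b then xs else [])
filterᵇ-const p []       true  _        = refl
filterᵇ-const p []       false _        = refl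
filterᵇ-const p (x ∷ xs) b     (px ∷ ps) with p x
filterᵇ-const p (x ∷ xs) true  (refl ∷ ps) | true  = cong (x ∷_) (filterᵇ-const p xs true ps)
filterᵇ-const p (x ∷ xs) false (refl ∷ ps) | false = filterᵇ-const p xs false ps

keys-map : ∀ v (cs : List ℕ) → All (λ (e : Entry) → proj₁ e ≡ v) (map (v ,_) cs)
keys-map v cs = map⁺ (All.universal (λ _ → refl) cs)

filterᵇ-lettersOf : ∀ r k K → filterᵇ (λ y → not (k ≡ᵇ proj₁ y)) (lettersOf r K) ≡ lettersOf r (removeKey k K)
filterᵇ-lettersOf r k []      = refl
filterᵇ-lettersOf r k (v ∷ K)
  rewrite filter-++ (T? ∘ (λ y → not (k ≡ᵇ proj₁ y))) (map (v ,_) (upTo r)) (lettersOf r K)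
        | filterᵇ-const (λ y → not (k ≡ᵇ proj₁ y)) (map (v ,_) (upTo r)) (not (k ≡ᵇ v))
            (All.map (cong (λ z → not (k ≡ᵇ z))) (keys-map v (upTo r)))
        | filterᵇ-lettersOf r k K
  with not (k ≡ᵇ v)
... | true  = refl
... | false = refl

lettersOf-keys : ∀ r K → All (λ a → notElem (proj₁ a) K ≡ false) (lettersOf r K)
lettersOf-keys r []      = []
lettersOf-keys r (v ∷ K) =
  ++⁺ (All.map (λ {a} a≡v → subst (λ z → notElem z (v ∷ K) ≡ false) (sym a≡v) (cong (λ b → not b ∧ notElem v K) (≡ᵇ-refl v)))
               (keys-map v (upTo r)))
      (All.map (λ {a} a∈K → trans (cong (not (proj₁ a ≡ᵇ v) ∧_) a∈K) (∧-zeroʳ _)) (lettersOf-keys r K))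

notElem⇒≢ᵇ : ∀ k k′ K → notElem k K ≡ true → notElem k′ K ≡ false → (k ≡ᵇ k′) ≡ false
notElem⇒≢ᵇ k k′ (v ∷ K) k∉ k′∈ with k ≡ᵇ v in k≟v | k′ ≡ᵇ v in k′≟v
... | false | true  = trans (cong (k ≡ᵇ_) (≡ᵇ-true⇒≡ k′ v k′≟v)) k≟v
... | false | false = notElem⇒≢ᵇ k k′ K k∉ k′∈

removeKey-notElem : ∀ k K → notElem k K ≡ true → removeKey k K ≡ K
removeKey-notElem k []      _  = refl
removeKey-notElem k (v ∷ K) k∉ with k ≡ᵇ v
... | false = cong (v ∷_) (removeKey-notElem k K k∉)

removeKey-≢ᵇ : ∀ k v K → (k ≡ᵇ v) ≡ false → removeKey k (v ∷ K) ≡ v ∷ removeKey k K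
removeKey-≢ᵇ k v K k≢v rewrite k≢v = refl

removeKey-head : ∀ k K → distinct (k ∷ K) ≡ true → removeKey k (k ∷ K) ≡ K
removeKey-head k K distinct-kK rewrite ≡ᵇ-refl k = removeKey-notElem k K (∧-conicalˡ _ _ distinct-kK)

length-removeKey : ∀ n k K → length K ≡ suc n → notElem k K ≡ false → distinct K ≡ true → length (removeKey k K) ≡ n
length-removeKey n k (v ∷ K) |K|≡1+n k∈ distinct-vK with k ≡ᵇ v in k≟v
... | true  rewrite ≡ᵇ-true⇒≡ k v k≟v = trans (cong length (removeKey-notElem v K (∧-conicalˡ _ _ distinct-vK))) (suc-injective |K|≡1+n)
... | false with n | K
...   | zero  | []     = ⊥-elim (true≢false k∈)
...   | suc m | x ∷ K′ = cong suc (length-removeKey m k (x ∷ K′) (suc-injective |K|≡1+n) k∈ (∧-conicalʳ (notElem v (x ∷ K′)) _ distinct-vK))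

notElem-removeKey : ∀ x k K → notElem x K ≡ true → notElem x (removeKey k K) ≡ true
notElem-removeKey x k []      _  = refl
notElem-removeKey x k (v ∷ K) x∉ with not (k ≡ᵇ v)
... | true  = cong₂ _∧_ (∧-conicalˡ _ _ x∉) (notElem-removeKey x k K (∧-conicalʳ _ _ x∉))
... | false = notElem-removeKey x k K (∧-conicalʳ _ _ x∉)

distinct-removeKey : ∀ k K → distinct K ≡ true → distinct (removeKey k K) ≡ true
distinct-removeKey k []      _           = refl
distinct-removeKey k (v ∷ K) distinct-vK with not (k ≡ᵇ v)
... | true  = cong₂ _∧_ (notElem-removeKey v k K (∧-conicalˡ _ _ distinct-vK)) (distinct-removeKey k K (∧-conicalʳ _ _ distinct-vK))
... | false = distinct-removeKey k K (∧-conicalʳ _ _ distinct-vK)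

∑-colourChoices-picks : ∀ r K → distinct K ≡ true → (G : Entry → List Entry → ℕ) →
  ∑ (colourChoices r K) (λ ch → ∑ (picks ch) (uncurry G))
    ≡ ∑ (lettersOf r K) (λ a → ∑ (colourChoices r (removeKey (proj₁ a) K)) (G a))
∑-colourChoices-picks r []      _           G = refl
∑-colourChoices-picks r (k ∷ K) distinct-kK G = begin
    ∑ (colourChoices r (k ∷ K)) (λ ch → ∑ (picks ch) (uncurry G))
  ≡⟨ ∑-colourChoices-∷ r k K _ ⟩
    ∑ (upTo r) (λ c → ∑ (colourChoices r K) (λ ch → ∑ (picks ((k , c) ∷ ch)) (uncurry G)))
  ≡⟨ trans (∑-cong (upTo r) (λ c → trans (∑-cong (colourChoices r K) (λ ch → cong (G (k , c) ch +_) (∑-map _ (picks ch) _)))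
                                           (∑-+ (colourChoices r K) _ _)))
           (∑-+ (upTo r) _ _) ⟩
    ∑ (upTo r) (λ c → ∑ (colourChoices r K) (G (k , c)))
      + ∑ (upTo r) (λ c → ∑ (colourChoices r K) (λ ch → ∑ (picks ch) (λ (a , rest) → G a ((k , c) ∷ rest))))
  ≡⟨ cong₂ _+_ head-letters other-letters ⟩
    ∑ (map (k ,_) (upTo r)) (λ a → ∑ (colourChoices r (removeKey (proj₁ a) (k ∷ K))) (G a))
      + ∑ (lettersOf r K) (λ a → ∑ (colourChoices r (removeKey (proj₁ a) (k ∷ K))) (G a))
  ≡⟨ ∑-++ (map (k ,_) (upTo r)) (lettersOf r K) _ ⟨
    ∑ (lettersOf r (k ∷ K)) (λ a → ∑ (colourChoices r (removeKey (proj₁ a) (k ∷ K))) (G a))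
  ∎
  where
  open ≡-Reasoning
  k∉K = ∧-conicalˡ _ _ distinct-kK
  head-letters : ∑ (upTo r) (λ c → ∑ (colourChoices r K) (G (k , c)))
    ≡ ∑ (map (k ,_) (upTo r)) (λ a → ∑ (colourChoices r (removeKey (proj₁ a) (k ∷ K))) (G a))
  head-letters = sym (trans (∑-map (k ,_) (upTo r) _)
    (∑-cong (upTo r) (λ c → cong (λ K′ → ∑ (colourChoices r K′) (G (k , c))) (removeKey-head k K distinct-kK))))
  other-letters : ∑ (upTo r) (λ c → ∑ (colourChoices r K) (λ ch → ∑ (picks ch) (λ (a , rest) → G a ((k , c) ∷ rest))))
    ≡ ∑ (lettersOf r K) (λ a → ∑ (colourChoices r (removeKey (proj₁ a) (k ∷ K))) (G a))
  other-letters = begin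
      ∑ (upTo r) (λ c → ∑ (colourChoices r K) (λ ch → ∑ (picks ch) (λ (a , rest) → G a ((k , c) ∷ rest))))
    ≡⟨ trans (∑-comm (upTo r) (colourChoices r K) _) (∑-cong (colourChoices r K) (λ ch → ∑-comm (upTo r) (picks ch) _)) ⟩
      ∑ (colourChoices r K) (λ ch → ∑ (picks ch) (λ (a , rest) → ∑ (upTo r) (λ c → G a ((k , c) ∷ rest))))
    ≡⟨ ∑-colourChoices-picks r K (∧-conicalʳ _ _ distinct-kK) (λ a rest → ∑ (upTo r) (λ c → G a ((k , c) ∷ rest))) ⟩
      ∑ (lettersOf r K) (λ a → ∑ (colourChoices r (removeKey (proj₁ a) K)) (λ ch → ∑ (upTo r) (λ c → G a ((k , c) ∷ ch))))
    ≡⟨ ∑-cong-All (All.map (λ {a} a∈K → sym (prepend-key a a∈K)) (lettersOf-keys r K)) ⟩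
      ∑ (lettersOf r K) (λ a → ∑ (colourChoices r (removeKey (proj₁ a) (k ∷ K))) (G a))
    ∎
    where
    prepend-key : ∀ a → notElem (proj₁ a) K ≡ false →
      ∑ (colourChoices r (removeKey (proj₁ a) (k ∷ K))) (G a)
        ≡ ∑ (colourChoices r (removeKey (proj₁ a) K)) (λ ch → ∑ (upTo r) (λ c → G a ((k , c) ∷ ch)))
    prepend-key a a∈K = begin
        ∑ (colourChoices r (removeKey (proj₁ a) (k ∷ K))) (G a)
      ≡⟨ cong (λ K′ → ∑ (colourChoices r K′) (G a)) (removeKey-≢ᵇ (proj₁ a) k K a≢k) ⟩
        ∑ (colourChoices r (k ∷ removeKey (proj₁ a) K)) (G a)
      ≡⟨ ∑-colourChoices-∷ r k (removeKey (proj₁ a) K) (G a) ⟩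
        ∑ (upTo r) (λ c → ∑ (colourChoices r (removeKey (proj₁ a) K)) (λ ch → G a ((k , c) ∷ ch)))
      ≡⟨ ∑-comm (upTo r) (colourChoices r (removeKey (proj₁ a) K)) (λ c ch → G a ((k , c) ∷ ch)) ⟩
        ∑ (colourChoices r (removeKey (proj₁ a) K)) (λ ch → ∑ (upTo r) (λ c → G a ((k , c) ∷ ch)))
      ∎
      where a≢k = trans (≡ᵇ-sym (proj₁ a) k) (notElem⇒≢ᵇ k (proj₁ a) K k∉K a∈K)

∑-distinctWords : ∀ r n K → length K ≡ n → distinct K ≡ true → (F : List Entry → ℕ) →
  ∑ (words n (lettersOf r K)) (λ w → 𝟙 (distinct (map proj₁ w)) * F w) ≡ ∑ (colourChoices r K) (λ ch → ∑ (permutations ch) F)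
∑-distinctWords r zero    []      _      _           F = refl
∑-distinctWords r (suc n) (k ∷ K) |kK|≡1+n distinct-kK F = begin
    ∑ (words (suc n) L) (λ w → 𝟙 (distinct (map proj₁ w)) * F w)
  ≡⟨ ∑-words-∷ n L _ ⟩
    ∑ L (λ a → ∑ (words n L) (λ w → 𝟙 (notElem (proj₁ a) (map proj₁ w) ∧ distinct (map proj₁ w)) * F (a ∷ w)))
  ≡⟨ ∑-cong L (λ a → ∑-cong (words n L) (λ w → split-head a w)) ⟩
    ∑ L (λ a → ∑ (words n L) (λ w → 𝟙 (allᵇ (λ y → not (proj₁ a ≡ᵇ proj₁ y)) w) * (𝟙 (distinct (map proj₁ w)) * F (a ∷ w))))
  ≡⟨ ∑-cong-All (All.map (λ {a} a∈kK → tail-words a a∈kK) (lettersOf-keys r (k ∷ K))) ⟩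
    ∑ L (λ a → ∑ (colourChoices r (removeKey (proj₁ a) (k ∷ K))) (λ ch → ∑ (permutations ch) (F ∘ (a ∷_))))
  ≡⟨ ∑-colourChoices-picks r (k ∷ K) distinct-kK (λ a ch → ∑ (permutations ch) (F ∘ (a ∷_))) ⟨
    ∑ (colourChoices r (k ∷ K)) (λ ch → ∑ (picks ch) (λ (a , rest) → ∑ (permutations rest) (F ∘ (a ∷_))))
  ≡⟨ ∑-cong-All (All.map (λ {ch} keys → by-first-letter {ch} keys) (colourChoices-keys r (k ∷ K))) ⟨
    ∑ (colourChoices r (k ∷ K)) (λ ch → ∑ (permutations ch) F)
  ∎
  where
  open ≡-Reasoning
  L = lettersOf r (k ∷ K)
  split-head : ∀ a w → 𝟙 (notElem (proj₁ a) (map proj₁ w) ∧ distinct (map proj₁ w)) * F (a ∷ w)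
    ≡ 𝟙 (allᵇ (λ y → not (proj₁ a ≡ᵇ proj₁ y)) w) * (𝟙 (distinct (map proj₁ w)) * F (a ∷ w))
  split-head a w = begin
      𝟙 (notElem (proj₁ a) (map proj₁ w) ∧ distinct (map proj₁ w)) * F (a ∷ w)
    ≡⟨ cong (_* F (a ∷ w)) (𝟙-∧ (notElem (proj₁ a) (map proj₁ w)) (distinct (map proj₁ w))) ⟩
      𝟙 (notElem (proj₁ a) (map proj₁ w)) * 𝟙 (distinct (map proj₁ w)) * F (a ∷ w)
    ≡⟨ cong (λ z → 𝟙 z * 𝟙 (distinct (map proj₁ w)) * F (a ∷ w)) (notElem-keys (proj₁ a) w) ⟩
      𝟙 (allᵇ (λ y → not (proj₁ a ≡ᵇ proj₁ y)) w) * 𝟙 (distinct (map proj₁ w)) * F (a ∷ w)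
    ≡⟨ *-assoc (𝟙 (allᵇ (λ y → not (proj₁ a ≡ᵇ proj₁ y)) w)) _ _ ⟩
      𝟙 (allᵇ (λ y → not (proj₁ a ≡ᵇ proj₁ y)) w) * (𝟙 (distinct (map proj₁ w)) * F (a ∷ w))
    ∎
  tail-words : ∀ a → notElem (proj₁ a) (k ∷ K) ≡ false →
    ∑ (words n L) (λ w → 𝟙 (allᵇ (λ y → not (proj₁ a ≡ᵇ proj₁ y)) w) * (𝟙 (distinct (map proj₁ w)) * F (a ∷ w)))
      ≡ ∑ (colourChoices r (removeKey (proj₁ a) (k ∷ K))) (λ ch → ∑ (permutations ch) (F ∘ (a ∷_)))
  tail-words a a∈kK = begin
      _
    ≡⟨ ∑-words-allᵇ n L _ _ ⟩
      ∑ (words n (filterᵇ (λ y → not (proj₁ a ≡ᵇ proj₁ y)) L)) (λ w → 𝟙 (distinct (map proj₁ w)) * F (a ∷ w))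
    ≡⟨ cong (λ L′ → ∑ (words n L′) (λ w → 𝟙 (distinct (map proj₁ w)) * F (a ∷ w))) (filterᵇ-lettersOf r (proj₁ a) (k ∷ K)) ⟩
      ∑ (words n (lettersOf r (removeKey (proj₁ a) (k ∷ K)))) (λ w → 𝟙 (distinct (map proj₁ w)) * F (a ∷ w))
    ≡⟨ ∑-distinctWords r n (removeKey (proj₁ a) (k ∷ K)) (length-removeKey n (proj₁ a) (k ∷ K) |kK|≡1+n a∈kK distinct-kK)
         (distinct-removeKey (proj₁ a) (k ∷ K) distinct-kK) (F ∘ (a ∷_)) ⟩
      _
    ∎
  by-first-letter : ∀ {ch} → map proj₁ ch ≡ k ∷ K →
    ∑ (permutations ch) F ≡ ∑ (picks ch) (λ (a , rest) → ∑ (permutations rest) (F ∘ (a ∷_)))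
  by-first-letter {x ∷ ch} _ = ∑-permutations-picks x ch F

notElem⇒All≢ : ∀ k K → notElem k K ≡ true → All (k ≢_) K
notElem⇒All≢ k []      _  = []
notElem⇒All≢ k (v ∷ K) k∉ =
  (λ k≡v → true≢false (trans (sym (≡ᵇ-refl k)) (trans (cong (k ≡ᵇ_) k≡v) (not≡true (∧-conicalˡ _ _ k∉)))))
  ∷ notElem⇒All≢ k K (∧-conicalʳ _ _ k∉)

All≢⇒notElem : ∀ k K → All (k ≢_) K → notElem k K ≡ true
All≢⇒notElem k []      []            = refl
All≢⇒notElem k (v ∷ K) (k≢v ∷ k∉K) with k ≡ᵇ v in k≟v
... | true  = ⊥-elim (k≢v (≡ᵇ-true⇒≡ k v k≟v))
... | false = All≢⇒notElem k K k∉K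

distinct⇒Unique : ∀ K → distinct K ≡ true → Unique K
distinct⇒Unique []      _          = []
distinct⇒Unique (k ∷ K) distinct-K =
  notElem⇒All≢ k K (∧-conicalˡ _ _ distinct-K) ∷ distinct⇒Unique K (∧-conicalʳ _ _ distinct-K)

Unique⇒distinct : ∀ K → Unique K → distinct K ≡ true
Unique⇒distinct []      []             = refl
Unique⇒distinct (k ∷ K) (k∉K ∷ unique) = cong₂ _∧_ (All≢⇒notElem k K k∉K) (Unique⇒distinct K unique)

values-length : ∀ d → length (values d) ≡ d
values-length d = trans (length-map suc (upTo d)) (length-upTo d)

values-distinct : ∀ d → distinct (values d) ≡ true
values-distinct d = Unique⇒distinct (values d) (Unique.map⁺ suc-injective (Unique.upTo⁺ d))

values-≤ : ∀ d → All (_≤ d) (values d)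
values-≤ d = map⁺ (all-upTo d)

-- Coloured permutations

walled-ext : ∀ d v c → v ≤ d → Walled (rightWall d) (ext (v , c))
walled-ext d v zero    v≤d = inj₁ (refl , T⇒≡true (<⇒<ᵇ (s≤s v≤d)))
walled-ext d v (suc c) _   = inj₂ (refl , refl)

walled-comparableʳ : ∀ {R} x → Walled R x → Comparable x R
walled-comparableʳ {R} x (inj₁ (_ , R≻x)) = below (≻-asym R x R≻x) R≻x
walled-comparableʳ {R} x (inj₂ (_ , x≻R)) = above x≻R (≻-asym x R x≻R)

walled-comparableˡ : ∀ {R} x → Walled R x → Comparable ∞₀ x
walled-comparableˡ x (inj₁ (∞₀≻x , _)) = above ∞₀≻x (≻-asym ∞₀ x ∞₀≻x)
walled-comparableˡ x (inj₂ (x≻∞₀ , _)) = below (≻-asym x ∞₀ x≻∞₀) x≻∞₀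

walled-linked : ∀ {R} → Comparable ∞₀ R → ∀ w → All (Walled R) w → Unique w → Linked Comparable (∞₀ ∷ w ++ [ R ])
walled-linked     ∞₀∼R []       _                      _                  = ∞₀∼R ∷ [-]
walled-linked {R} ∞₀∼R (x ∷ xs) (x-walled ∷ xs-walled) (x∉xs ∷ xs-unique) =
  walled-comparableˡ x x-walled ∷ from x xs x-walled xs-walled x∉xs xs-unique
  where
  from : ∀ x xs → Walled R x → All (Walled R) xs → All (x ≢_) xs → Unique xs → Linked Comparable (x ∷ xs ++ [ R ])
  from x []       x-walled _                   _              _                  = walled-comparableʳ x x-walled ∷ [-]
  from x (y ∷ ys) _        (y-walled ∷ ys-walled) (x≢y ∷ _) (y∉ys ∷ ys-unique) =
    comparable x y x≢y ∷ from y ys y-walled ys-walled y∉ys ys-unique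

lastAgrees : Bool → List Entry → Bool
lastAgrees ℓ σ = agree ℓ (lastColor σ ≡ᵇ 0)

-- A-ending d r true and A-ending d r false are A⁰ d r and A≠0 d r by definition.
A-ending : ℕ → ℕ → Bool → List (List Entry)
A-ending d r ℓ = filterᵇ (lastAgrees ℓ) (A d r)

low-ext : ∀ e → low (ext e) ≡ (proj₂ e ≡ᵇ 0)
low-ext (v , zero)  = refl
low-ext (v , suc c) = refl

low-lastOr-ext : ∀ e es → low (lastOr (ext e) (map ext es)) ≡ (lastColor (e ∷ es) ≡ᵇ 0)
low-lastOr-ext e []        = low-ext e
low-lastOr-ext e (e′ ∷ es) = low-lastOr-ext e′ es

indicators-ext : ∀ d ℓ σ (g : ℕ → ℕ) → 𝟙 (firstColor0 σ) * (𝟙 (lastAgrees ℓ σ) * g (des d σ))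
  ≡ 𝟙 (headIs low (map ext σ)) * (𝟙 (lastIs (onSide ℓ) (map ext σ)) * g (descents (map ext σ) (rightWall d)))
indicators-ext d ℓ []       g = refl
indicators-ext d ℓ (e ∷ es) g =
  trans (cong₂ (λ a b → 𝟙 a * (𝟙 b * g (des d (e ∷ es)))) (sym (low-ext e)) (cong (agree ℓ) (sym (low-lastOr-ext e es))))
    (cong (λ D → 𝟙 (low (ext e)) * (𝟙 (lastIs (onSide ℓ) (map ext (e ∷ es))) * g D)) (countDesc-++ (map ext (e ∷ es)) (rightWall d)))

∑-A-ending : ∀ d r ℓ (φ : List Entry → ℕ) → ∑ (A-ending d r ℓ) φ
  ≡ ∑ (colourChoices r (values d)) (λ ch → ∑ (permutations ch) (λ σ → 𝟙 (firstColor0 σ) * (𝟙 (lastAgrees ℓ σ) * φ σ)))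
∑-A-ending d r ℓ φ =
  trans (∑-filterᵇ (lastAgrees ℓ) (A d r) φ)
    (trans (∑-filterᵇ firstColor0 (colPerms d r) _)
      (trans (∑-filterᵇ (λ w → distinct (map proj₁ w)) (words d (letters d r)) _)
        (∑-distinctWords r d (values d) (values-length d) (values-distinct d) _)))

ext-injective : ∀ {e e′} → ext e ≡ ext e′ → e ≡ e′
ext-injective refl = refl

module _ (t d : ℕ) (ℓ : Bool) (ch : List Entry) (keys : map proj₁ ch ≡ values d) where

  private
    R = rightWall d
    X = map ext ch

    X-length : length X ≡ d
    X-length = trans (length-map ext ch) (trans (sym (length-map proj₁ ch)) (trans (cong length keys) (values-length d)))

    X-walled : All (Walled R) X
    X-walled = map⁺ (All.map (λ {e} → walled-ext d (proj₁ e) (proj₂ e)) (map⁻ (subst (All (_≤ d)) (sym keys) (values-≤ d))))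

    X-unique : Unique X
    X-unique = Unique.map⁺ ext-injective (Unique.map⁻ (distinct⇒Unique (map proj₁ ch)
      (subst (λ K → distinct K ≡ true) (sym keys) (values-distinct d))))

  descents-choice : ∑ (permutations ch) (λ σ → 𝟙 (firstColor0 σ) * (𝟙 (lastAgrees ℓ σ) * t ^ des d σ))
    ≡ ∑ (permutations X) (λ w → 𝟙 (headIs low w) * endWeight ℓ (γWeight t ∞₀ R) w)
  descents-choice = begin
      ∑ (permutations ch) (λ σ → 𝟙 (firstColor0 σ) * (𝟙 (lastAgrees ℓ σ) * t ^ des d σ))
    ≡⟨ ∑-cong (permutations ch) (λ σ → indicators-ext d ℓ σ (t ^_)) ⟩
      ∑ (permutations ch) (λ σ → 𝟙 (headIs low (map ext σ)) * endWeight ℓ (desWeight t R) (map ext σ))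
    ≡⟨ ∑-permutations-map ext ch _ ⟨
      ∑ (permutations X) (λ w → 𝟙 (headIs low w) * endWeight ℓ (desWeight t R) w)
    ≡⟨ γ-expansion-walled t R d X (≤-reflexive X-length) X-walled X-unique true ℓ ⟩
      ∑ (permutations X) (λ w → 𝟙 (headIs low w) * endWeight ℓ (γWeight t ∞₀ R) w)
    ∎
    where open ≡-Reasoning

  γSummands-choice :
    ∑ (permutations ch) (λ σ → 𝟙 (firstColor0 σ) * (𝟙 (lastAgrees ℓ σ) * γSummand t (γDegree ℓ d) (des d σ) (slides d σ)))
    ≡ ∑ (permutations X) (λ w → 𝟙 (headIs low w) * endWeight ℓ (γWeight t ∞₀ R) w)
  γSummands-choice = begin
      ∑ (permutations ch) (λ σ → 𝟙 (firstColor0 σ) * (𝟙 (lastAgrees ℓ σ) * γSummand t (γDegree ℓ d) (des d σ) (slides d σ)))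
    ≡⟨ ∑-cong (permutations ch) (λ σ → indicators-ext d ℓ σ (λ D → γSummand t (γDegree ℓ d) D (slides d σ))) ⟩
      ∑ (permutations ch) (λ σ → summand (map ext σ))
    ≡⟨ ∑-permutations-map ext ch summand ⟨
      ∑ (permutations X) summand
    ≡⟨ ∑-cong-All (All.map (λ {w} → per-word w) (permutations-↭ X)) ⟩
      ∑ (permutations X) (λ w → 𝟙 (headIs low w) * endWeight ℓ (γWeight t ∞₀ R) w)
    ∎
    where
    open ≡-Reasoning
    summand : List XEntry → ℕ
    summand w = 𝟙 (headIs low w) * (𝟙 (lastIs (onSide ℓ) w) * γSummand t (γDegree ℓ d) (descents w R) (segmentCount ∞₀ (w ++ [ R ])))
    per-word : ∀ w → w ↭ X → summand w ≡ 𝟙 (headIs low w) * endWeight ℓ (γWeight t ∞₀ R) w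
    per-word []       _ = refl
    per-word (x ∷ xs) π = 𝟙-guard-cong (low x) (λ x-low → 𝟙-guard-cong (lastIs (onSide ℓ) (x ∷ xs)) (λ last-on →
      γSummand≡γWeight t d ℓ x xs (walled-linked (above refl refl) (x ∷ xs) w-walled (Unique-↭ (↭-sym π) X-unique))
        w-walled (trans (↭-length π) X-length) x-low last-on))
      where w-walled = All-resp-↭ (↭-sym π) X-walled

𝟙-<ᵇ-suc : ∀ D k → 𝟙 (D <ᵇ k) + 𝟙 (D ≡ᵇ k) ≡ 𝟙 (D <ᵇ suc k)
𝟙-<ᵇ-suc zero    zero    = refl
𝟙-<ᵇ-suc zero    (suc k) = refl
𝟙-<ᵇ-suc (suc D) zero    = refl
𝟙-<ᵇ-suc (suc D) (suc k) = 𝟙-<ᵇ-suc D k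

∑-upTo-≡ᵇ : ∀ D k → ∑ (upTo k) (λ i → 𝟙 (D ≡ᵇ i)) ≡ 𝟙 (D <ᵇ k)
∑-upTo-≡ᵇ D zero    = refl
∑-upTo-≡ᵇ D (suc k) = begin
    ∑ (upTo (suc k)) (λ i → 𝟙 (D ≡ᵇ i))
  ≡⟨ cong (λ is → ∑ is (λ i → 𝟙 (D ≡ᵇ i))) (upTo-∷ʳ k) ⟨
    ∑ (upTo k ++ [ k ]) (λ i → 𝟙 (D ≡ᵇ i))
  ≡⟨ ∑-++ (upTo k) [ k ] _ ⟩
    ∑ (upTo k) (λ i → 𝟙 (D ≡ᵇ i)) + (𝟙 (D ≡ᵇ k) + 0)
  ≡⟨ cong₂ _+_ (∑-upTo-≡ᵇ D k) (+-identityʳ _) ⟩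
    𝟙 (D <ᵇ k) + 𝟙 (D ≡ᵇ k)
  ≡⟨ 𝟙-<ᵇ-suc D k ⟩
    𝟙 (D <ᵇ suc k)
  ∎
  where open ≡-Reasoning

∑-upTo-select : ∀ D k (Q : ℕ → Bool) (a c : ℕ → ℕ) →
  ∑ (upTo k) (λ i → (𝟙 ((D ≡ᵇ i) ∧ Q i) * a i) * c i) ≡ 𝟙 (D <ᵇ k) * ((𝟙 (Q D) * a D) * c D)
∑-upTo-select D k Q a c =
  trans (∑-cong (upTo k) select) (trans (∑-*ʳ (upTo k) _ (λ i → 𝟙 (D ≡ᵇ i))) (cong (_* ((𝟙 (Q D) * a D) * c D)) (∑-upTo-≡ᵇ D k)))
  where
  select : ∀ i → (𝟙 ((D ≡ᵇ i) ∧ Q i) * a i) * c i ≡ 𝟙 (D ≡ᵇ i) * ((𝟙 (Q D) * a D) * c D)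
  select i with D ≡ᵇ i in D≟i
  ... | false = refl
  ... | true rewrite ≡ᵇ-true⇒≡ D i D≟i = sym (+-identityʳ _)

gammaSum≡∑γSummand : ∀ t n d (S : List (List Entry)) →
  gammaSum (n / 2) n (aCount d S) t ≡ ∑ S (λ σ → γSummand t n (des d σ) (slides d σ))
gammaSum≡∑γSummand t n d S = begin
    ∑ (upTo (suc (n / 2))) (λ i → aCount d S i * t ^ i * (1 + t) ^ (n ∸ 2 * i))
  ≡⟨ ∑-cong (upTo (suc (n / 2))) (λ i → trans (cong (λ z → z * t ^ i * (1 + t) ^ (n ∸ 2 * i)) (length-filterᵇ _ S))
       (trans (cong (_* (1 + t) ^ (n ∸ 2 * i)) (sym (∑-*ʳ S (t ^ i) _))) (sym (∑-*ʳ S ((1 + t) ^ (n ∸ 2 * i)) _)))) ⟩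
    ∑ (upTo (suc (n / 2))) (λ i → ∑ S (λ σ → (𝟙 ((des d σ ≡ᵇ i) ∧ (slides d σ ≡ᵇ suc i)) * t ^ i) * (1 + t) ^ (n ∸ 2 * i)))
  ≡⟨ ∑-comm (upTo (suc (n / 2))) S _ ⟩
    ∑ S (λ σ → ∑ (upTo (suc (n / 2))) (λ i → (𝟙 ((des d σ ≡ᵇ i) ∧ (slides d σ ≡ᵇ suc i)) * t ^ i) * (1 + t) ^ (n ∸ 2 * i)))
  ≡⟨ ∑-cong S (λ σ → ∑-upTo-select (des d σ) (suc (n / 2)) (λ i → slides d σ ≡ᵇ suc i) (t ^_) (λ i → (1 + t) ^ (n ∸ 2 * i))) ⟩
    ∑ S (λ σ → γSummand t n (des d σ) (slides d σ))
  ∎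
  where open ≡-Reasoning

γ-expansion-A-ending : ∀ t d r ℓ →
  desPoly d (A-ending d r ℓ) t ≡ gammaSum (γDegree ℓ d / 2) (γDegree ℓ d) (aCount d (A-ending d r ℓ)) t
γ-expansion-A-ending t d r ℓ = begin
    ∑ (A-ending d r ℓ) (λ σ → t ^ des d σ)
  ≡⟨ ∑-A-ending d r ℓ _ ⟩
    ∑ (colourChoices r (values d)) (λ ch → ∑ (permutations ch) (λ σ → 𝟙 (firstColor0 σ) * (𝟙 (lastAgrees ℓ σ) * t ^ des d σ)))
  ≡⟨ ∑-cong-All (All.map (λ {ch} keys → trans (descents-choice t d ℓ ch keys) (sym (γSummands-choice t d ℓ ch keys)))
                         (colourChoices-keys r (values d))) ⟩
    ∑ (colourChoices r (values d)) (λ ch → ∑ (permutations ch)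
      (λ σ → 𝟙 (firstColor0 σ) * (𝟙 (lastAgrees ℓ σ) * γSummand t (γDegree ℓ d) (des d σ) (slides d σ))))
  ≡⟨ ∑-A-ending d r ℓ _ ⟨
    ∑ (A-ending d r ℓ) (λ σ → γSummand t (γDegree ℓ d) (des d σ) (slides d σ))
  ≡⟨ gammaSum≡∑γSummand t (γDegree ℓ d) d (A-ending d r ℓ) ⟨
    gammaSum (γDegree ℓ d / 2) (γDegree ℓ d) (aCount d (A-ending d r ℓ)) t
  ∎
  where open ≡-Reasoning

-- The identities also hold for d = 0 and r = 0.
theorem3p4 : (d r : ℕ) → 1 ≤ d → 1 ≤ r → (t : ℕ) →
      (desPoly d (A⁰ d r) t ≡ gammaSum ((d ∸ 1) / 2) (d ∸ 1) (aCount d (A⁰ d r)) t)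
    × (desPoly d (A≠0 d r) t ≡ gammaSum (d / 2) d (aCount d (A≠0 d r)) t)
theorem3p4 d r _ _ t = γ-expansion-A-ending t d r true , γ-expansion-A-ending t d r false
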